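{- Run Algorithm PMR (defined in the context) with parameters $\gamma\ge 1$ and $0<R^*<1/2$ on an instance, and suppose that at the end of the peel-off phase $R>R^*$. Then $$ALG_P+ALG_R\ \ge\ nW\cdot\Big(\frac{2}{3}+\frac{\gamma-1}{3\gamma}R^*+\frac{1}{12\gamma}{R^*}^2\Big).$$
   Context: Instance: a finite set $V$ of $n$ items (vertices of $G=(V,E)$) with nonnegative dissimilarity weights $w_{i,j}=w_{j,i}$; $W=\sum_{(i,j)\in E}w_{i,j}$. A hierarchical clustering tree $T$ is a rooted tree with leaf set $V$; $T_{i,j}$ is the subtree rooted at the least common ancestor of $i,j$ and $|T_{i,j}|$ its number of leaves; $Rev(T)=\sum_{i,j}w_{i,j}|T_{i,j}|$. Random Partitioning: recursively split every cluster with at least two items into two nonempty parts uniformly at random (each item independently and uniformly on one of two sides, repeating if a side is empty). Algorithm PMR with parameters $\gamma,R^*$: set $V_B\leftarrow V$, $E_B\leftarrow E$. While some $v\in V_B$ has $W_v=\sum_{u\in V_B,(v,u)\in E_B}w_{v,u}\ge\gamma\frac{2W}{n}$ (original $W,n$), choose $v^*$ with the largest $W_v$, split the current cluster $V_B$ into $\{v^*\}$ and $V_B\setminus\{v^*\}$, delete $v^*$ from $V_B$ and its incident edges from $E_B$ (peel-off phase). The deleted vertices are red, the edges with at least one red endpoint are red edges, of total weight $W_R$; $R=W_R/W$. If $R>R^*$, run Random Partitioning on $V_B$; otherwise run the Goemans–Williamson max-cut algorithm on $(V_B,E_B)$, split $V_B$ accordingly, and run Random Partitioning on both sides. Let $T$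 be the output tree. $ALG_P=\sum_{\text{red edges }(i,j)}w_{i,j}|T_{i,j}|$, and (in the case $R>R^*$) $ALG_R$ is the expected value of $\sum_{(i,j)\in E_B}w_{i,j}|T_{i,j}|$ over the randomness of Random Partitioning, with $E_B$ the edge set remaining after the peel-off phase.
   Formalization: The dissimilarity weights $w_{i,j}$ and the parameters γ and R* take rational values. -}

module Defs where

open import Data.Bool using (Bool; true; false; if_then_else_; _∧_; _∨_; not)
open import Data.Nat as ℕ using (ℕ; zero; suc; _<ᵇ_)
open import Data.Fin using (Fin; toℕ; _≟_)
open import Data.List using (List; []; _∷_; _++_; [_]; length; map; foldr; allFin; concatMap; filter)
open import Data.Maybe using (Maybe; just; nothing)
open import Data.Product using (_×_; _,_)
open import Data.Integer using (+_)
open import Data.Rational using (ℚ; 0ℚ; 1ℚ; _+_; _*_; _≤_; _<_; _÷_; _/_; ≢-nonZero)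
import Data.Rational.Properties as ℚP
open import Relation.Nullary using (yes; no)
open import Relation.Nullary.Decidable using (⌊_⌋)
open import Relation.Binary.PropositionalEquality using (_≡_)

-- rational division, with the (unused) convention p ÷' 0 = 0
_÷'_ : ℚ → ℚ → ℚ
p ÷' q with q ℚP.≟ 0ℚ
... | yes _ = 0ℚ
... | no q≢0 = _÷_ p q {{≢-nonZero q≢0}}

ℕ→ℚ : ℕ → ℚ
ℕ→ℚ k = (+ k) / 1

sumℚ : List ℚ → ℚ
sumℚ = foldr _+_ 0ℚ

module Instance (n : ℕ) where

  mem : Fin n → List (Fin n) → Bool
  mem v [] = false
  mem v (u ∷ us) = ⌊ v ≟ u ⌋ ∨ mem v us

  -- Σ over unordered pairs {i,j}, i ≠ j (encoded as toℕ i < toℕ j)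
  sumPairs : (Fin n → Fin n → ℚ) → ℚ
  sumPairs f = sumℚ (map (λ i → sumℚ (map (λ j → if toℕ i <ᵇ toℕ j then f i j else 0ℚ) (allFin n))) (allFin n))

  totalW : (Fin n → Fin n → ℚ) → ℚ
  totalW w = sumPairs w

  -- W_v in the current graph (V_B, E_B), where V_B = V minus the removed list
  Wv : (Fin n → Fin n → ℚ) → List (Fin n) → Fin n → ℚ
  Wv w removed v =
    sumℚ (map (λ u → if ⌊ u ≟ v ⌋ ∨ mem u removed then 0ℚ else w v u) (allFin n))

  threshold : (Fin n → Fin n → ℚ) → ℚ → ℚ
  threshold w γ = γ * ((ℕ→ℚ 2 * totalW w) ÷' ℕ→ℚ n)

  -- PeelOff w γ removed peel : starting from V_B = V ∖ removed, the peel-off phase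
  -- removes exactly the vertices of 'peel', in this order (any tie-breaking among maxima).
  data PeelOff (w : Fin n → Fin n → ℚ) (γ : ℚ) (removed : List (Fin n)) : List (Fin n) → Set where
    stop : (∀ v → mem v removed ≡ false → Wv w removed v < threshold w γ) →
           PeelOff w γ removed []
    step : ∀ v rest →
           mem v removed ≡ false →
           threshold w γ ≤ Wv w removed v →
           (∀ u → mem u removed ≡ false → Wv w removed u ≤ Wv w removed v) →
           PeelOff w γ (removed ++ [ v ]) rest →
           PeelOff w γ removed (v ∷ rest)

  redW : (Fin n → Fin n → ℚ) → List (Fin n) → ℚ
  redW w peel = sumPairs (λ i j → if mem i peel ∨ mem j peel then w i j else 0ℚ)

  remaining : List (Fin n) → List (Fin n)
  remaining peel = filter (λ v → Data.Bool._≟_ (mem v peel) false) (allFin n)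

  -- hierarchical clustering trees (full binary trees: every split is into two parts)
  data Tree : Set where
    leaf : Fin n → Tree
    node : Tree → Tree → Tree

  size : Tree → ℕ
  size (leaf _) = 1
  size (node l r) = size l ℕ.+ size r

  inT : Fin n → Tree → Bool
  inT v (leaf u) = ⌊ v ≟ u ⌋
  inT v (node l r) = inT v l ∨ inT v r

  lcaSize : Tree → Fin n → Fin n → ℕ
  lcaSize (leaf _) i j = 1
  lcaSize (node l r) i j =
    if inT i l ∧ inT j l then lcaSize l i j
    else if inT i r ∧ inT j r then lcaSize r i j
    else size l ℕ.+ size r

  assignments : ℕ → List (List Bool)
  assignments zero = [ [] ]
  assignments (suc m) = concatMap (λ a → (true ∷ a) ∷ (false ∷ a) ∷ []) (assignments m)

  sideOf : Bool → List (Fin n) → List Bool → List (Fin n)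
  sideOf b (x ∷ xs) (c ∷ cs) = if ⌊ Data.Bool._≟_ c b ⌋ then x ∷ sideOf b xs cs else sideOf b xs cs
  sideOf b _ _ = []

  nonEmpty : List (Fin n) → Bool
  nonEmpty [] = false
  nonEmpty (_ ∷ _) = true

  -- Random Partitioning, as a finite probability distribution over trees
  -- (fuel ≥ size of the cluster; each item independently uniformly on a side,
  --  conditioned on both sides nonempty)
  RP : ℕ → List (Fin n) → List (ℚ × Tree)
  RP _ [] = []
  RP _ (v ∷ []) = [ (1ℚ , leaf v) ]
  RP zero (_ ∷ _ ∷ _) = []
  RP (suc k) S@(_ ∷ _ ∷ _) =
    let valid = filter (λ a → Data.Bool._≟_ (nonEmpty (sideOf true S a) ∧ nonEmpty (sideOf false S a)) true)
                       (assignments (length S))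
        p = 1ℚ ÷' ℕ→ℚ (length valid)
    in concatMap (λ a →
         concatMap (λ { (q₁ , t₁) →
           map (λ { (q₂ , t₂) → (p * q₁ * q₂ , node t₁ t₂) }) (RP k (sideOf false S a)) })
           (RP k (sideOf true S a)))
       valid

  RandomPartitioning : List (Fin n) → List (ℚ × Tree)
  RandomPartitioning S = RP (length S) S

  caterpillar : List (Fin n) → Maybe Tree → Maybe Tree
  caterpillar [] tB = tB
  caterpillar (v ∷ vs) tB with caterpillar vs tB
  ... | nothing = just (leaf v)
  ... | just t = just (node (leaf v) t)

  -- distribution of the output tree T in the case R > R*
  outputDist : List (Fin n) → List (ℚ × Maybe Tree)
  outputDist peel with remaining peel
  ... | [] = [ (1ℚ , caterpillar peel nothing) ]
  ... | VB@(_ ∷ _) = map (λ { (q , t) → (q , caterpillar peel (just t)) }) (RandomPartitioning VB)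

  lcaSizeM : Maybe Tree → Fin n → Fin n → ℕ
  lcaSizeM nothing _ _ = 0
  lcaSizeM (just t) i j = lcaSize t i j

  expectedCost : (Fin n → Fin n → ℚ) → List (Fin n) → (Fin n → Fin n → Bool) → ℚ
  expectedCost w peel sel =
    sumℚ (map (λ { (q , t) → q * sumPairs (λ i j → if sel i j then w i j * ℕ→ℚ (lcaSizeM t i j) else 0ℚ) })
              (outputDist peel))

  ALG-P : (Fin n → Fin n → ℚ) → List (Fin n) → ℚ
  ALG-P w peel = expectedCost w peel (λ i j → mem i peel ∨ mem j peel)

  ALG-R : (Fin n → Fin n → ℚ) → List (Fin n) → ℚ
  ALG-R w peel = expectedCost w peel (λ i j → not (mem i peel ∨ mem j peel))

module Submission where

-- The output tree is a caterpillar: the peeled vertices v₀, v₁, … are split off one at a time, so a red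
-- edge whose first peeled endpoint is v_t has |T_ij| = n − t and ALG_P = Σ_t a_t (n − t), where a_t is
-- the degree W_{v_t} at the moment v_t is peeled.  These degrees are nonincreasing (each peeled vertex has
-- maximum degree, and degrees only drop), so Chebyshev's sum inequality bounds ALG_P from below by
-- W_R = Σ_t a_t and the number k of peeled vertices, while a_t ≥ 2γW/n gives 2γkW ≤ n W_R.  On the
-- m remaining vertices, Random Partitioning separates two items in a cluster of expected size at least
-- 2/3 of the current one (an exact count over all 2^m side assignments), so ALG_R ≥ (2m/3)(W − W_R).
-- With R* W < W_R ≤ W and γ ≥ 1 the three estimates combine into the bound through an explicit
-- nonnegative polynomial certificate.

open import Defs
open import Data.Bool using (Bool; true; false; if_then_else_; _∧_; _∨_; not)
import Data.Bool as Bool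
import Data.Bool.Properties as Boolₚ
import Data.Nat
open import Data.Nat as ℕ using (ℕ; zero; suc; _<ᵇ_)
import Data.Nat.Properties as ℕₚ
import Algebra.Properties.CommutativeSemigroup ℕₚ.+-commutativeSemigroup as ℕ+
open import Data.Nat.ListAction using (sum)
open import Data.Nat.ListAction.Properties using (sum-++)
open import Data.Nat.Tactic.RingSolver using (solve-∀)
open import Data.Nat.Coprimality using (1-coprimeTo) renaming (sym to coprime-sym)
open import Data.Integer as ℤ using ()
open import Data.Fin as Fin using (Fin; toℕ)
import Data.Fin.Properties as Finₚ
open import Data.List using (List; []; _∷_; _++_; [_]; length; map; concatMap; filter; allFin)
import Data.List.Properties as Listₚ
open import Data.List.Membership.Propositional using (_∈_; find)
open import Data.List.Membership.Propositional.Properties using (∈-allFin; ∈-concatMap⁻; ∈-filter⁻; ∈-filter⁺; ∈-++⁺ˡ; ∈-++⁺ʳ)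
open import Data.List.Relation.Unary.Any using (here; there)
open import Data.List.Relation.Unary.All as All using (All; []; _∷_)
import Data.List.Relation.Unary.All.Properties as Allₚ
open import Data.List.Relation.Unary.AllPairs using ([]; _∷_)
open import Data.List.Relation.Unary.Linked as Linked using (Linked; []; [-]; _∷_)
open import Data.List.Relation.Unary.Unique.Propositional using (Unique)
open import Data.List.Relation.Unary.Unique.Propositional.Properties using (allFin⁺; filter⁺)
open import Data.Maybe using (Maybe; just; nothing)
open import Data.Product using (_×_; _,_; proj₁; proj₂)
open import Data.Unit using (⊤; tt)
open import Data.Empty using (⊥-elim)
open import Function using (_∘_)
open import Relation.Binary using (tri<; tri≈; tri>)
open import Relation.Binary.PropositionalEquality hiding ([_])
open import Relation.Nullary using (Dec; yes; no)
open import Relation.Nullary.Decidable using (⌊_⌋; ¬?)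
open import Data.Rational using (ℚ)

∨≡false⇒ˡ : ∀ {a b} → (a ∨ b) ≡ false → a ≡ false
∨≡false⇒ˡ {false} _ = refl

∨≡false⇒ʳ : ∀ {a b} → (a ∨ b) ≡ false → b ≡ false
∨≡false⇒ʳ {false} b≡false = b≡false

∧≡true⇒ˡ : ∀ {a b} → (a ∧ b) ≡ true → a ≡ true
∧≡true⇒ˡ {true} _ = refl

∧≡true⇒ʳ : ∀ {a b} → (a ∧ b) ≡ true → b ≡ true
∧≡true⇒ʳ {true} b≡true = b≡true

module Membership (n : ℕ) where
  open Instance n

  NoDup : List (Fin n) → Set
  NoDup [] = ⊤
  NoDup (x ∷ xs) = (mem x xs ≡ false) × NoDup xs

  ≟-refl : ∀ (x : Fin n) → ⌊ x Fin.≟ x ⌋ ≡ true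
  ≟-refl x with x Fin.≟ x
  ... | yes _ = refl
  ... | no x≢x = ⊥-elim (x≢x refl)

  mem-++ : ∀ x (xs ys : List (Fin n)) → mem x (xs ++ ys) ≡ mem x xs ∨ mem x ys
  mem-++ x [] ys = refl
  mem-++ x (u ∷ xs) ys rewrite mem-++ x xs ys = sym (Boolₚ.∨-assoc ⌊ x Fin.≟ u ⌋ (mem x xs) (mem x ys))

  mem-snoc : ∀ x (xs : List (Fin n)) v → mem x (xs ++ [ v ]) ≡ mem x xs ∨ ⌊ x Fin.≟ v ⌋
  mem-snoc x xs v rewrite mem-++ x xs [ v ] = cong (mem x xs ∨_) (Boolₚ.∨-identityʳ _)

  ∈⇒mem≡true : ∀ {x xs} → x ∈ xs → mem x xs ≡ true
  ∈⇒mem≡true {x} (here refl) rewrite ≟-refl x = refl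
  ∈⇒mem≡true {x} {u ∷ xs} (there x∈xs) rewrite ∈⇒mem≡true x∈xs = Boolₚ.∨-zeroʳ _

  mem-allFin : ∀ x → mem x (allFin n) ≡ true
  mem-allFin x = ∈⇒mem≡true (∈-allFin x)

  firstHit : List (Fin n) → Fin n → Fin n → ℕ
  firstHit [] i j = 0
  firstHit (v ∷ vs) i j = if ⌊ i Fin.≟ v ⌋ ∨ ⌊ j Fin.≟ v ⌋ then 0 else suc (firstHit vs i j)

module Splits (n : ℕ) where
  open Instance n
  open Membership n

  T-side F-side : List (Fin n) → List Bool → List (Fin n)
  T-side = sideOf true
  F-side = sideOf false

  mem-sides : ∀ x S a → length a ≡ length S → mem x S ≡ mem x (T-side S a) ∨ mem x (F-side S a)
  mem-sides x [] [] _ = refl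
  mem-sides x (u ∷ S) (true ∷ a) e rewrite mem-sides x S a (ℕₚ.suc-injective e) = sym (Boolₚ.∨-assoc ⌊ x Fin.≟ u ⌋ _ _)
  mem-sides x (u ∷ S) (false ∷ a) e rewrite mem-sides x S a (ℕₚ.suc-injective e) = ∨-swap ⌊ x Fin.≟ u ⌋ (mem x (T-side S a)) (mem x (F-side S a))
    where
    ∨-swap : ∀ a b c → a ∨ (b ∨ c) ≡ b ∨ (a ∨ c)
    ∨-swap true b c = sym (Boolₚ.∨-zeroʳ b)
    ∨-swap false b c = refl

  length-sides : ∀ S a → length a ≡ length S → length (T-side S a) ℕ.+ length (F-side S a) ≡ length S
  length-sides [] [] _ = refl
  length-sides (u ∷ S) (true ∷ a) e = cong suc (length-sides S a (ℕₚ.suc-injective e))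
  length-sides (u ∷ S) (false ∷ a) e = trans (ℕₚ.+-suc _ _) (cong suc (length-sides S a (ℕₚ.suc-injective e)))

  mem-sideOf⇒mem : ∀ x b S a → mem x (sideOf b S a) ≡ true → mem x S ≡ true
  mem-sideOf⇒mem x b [] a ()
  mem-sideOf⇒mem x b (u ∷ S) [] ()
  mem-sideOf⇒mem x b (u ∷ S) (c ∷ a) h with ⌊ Bool._≟_ c b ⌋
  ... | false = trans (cong (⌊ x Fin.≟ u ⌋ ∨_) (mem-sideOf⇒mem x b S a h)) (Boolₚ.∨-zeroʳ _)
  ... | true with x Fin.≟ u
  ...   | yes _ = refl
  ...   | no _ = mem-sideOf⇒mem x b S a h

  NoDup-sideOf : ∀ b S a → NoDup S → NoDup (sideOf b S a)
  NoDup-sideOf b [] a _ = tt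
  NoDup-sideOf b (x ∷ S) [] _ = tt
  NoDup-sideOf b (x ∷ S) (c ∷ a) (x∉S , nd) with ⌊ Bool._≟_ c b ⌋
  ... | false = NoDup-sideOf b S a nd
  ... | true with mem x (sideOf b S a) in x∈side
  ...   | false = refl , NoDup-sideOf b S a nd
  ...   | true with trans (sym x∉S) (mem-sideOf⇒mem x b S a x∈side)
  ...     | ()

  length-∈-assignments : ∀ m a → a ∈ assignments m → length a ≡ m
  length-∈-assignments zero a (here refl) = refl
  length-∈-assignments (suc m) a a∈ with find (∈-concatMap⁻ (λ a → (true ∷ a) ∷ (false ∷ a) ∷ []) {xs = assignments m} a∈)
  ... | a′ , a′∈ , here refl = cong suc (length-∈-assignments m a′ a′∈)
  ... | a′ , a′∈ , there (here refl) = cong suc (length-∈-assignments m a′ a′∈)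

  ∈-assignments : ∀ a → a ∈ assignments (length a)
  ∈-assignments [] = here refl
  ∈-assignments (b ∷ a) = ∈-concatMap⁺ (assignments (length a)) (∈-assignments a) (b∈ b)
    where
    ∈-concatMap⁺ : ∀ {A B : Set} {f : A → List B} {x : A} {y : B} (L : List A) → x ∈ L → y ∈ f x → y ∈ concatMap f L
    ∈-concatMap⁺ {f = f} (x ∷ L) (here refl) y∈ = ∈-++⁺ˡ y∈
    ∈-concatMap⁺ {f = f} (x ∷ L) (there x∈) y∈ = ∈-++⁺ʳ (f x) (∈-concatMap⁺ L x∈ y∈)
    b∈ : ∀ b → (b ∷ a) ∈ (true ∷ a) ∷ (false ∷ a) ∷ []
    b∈ true = here refl
    b∈ false = there (here refl)

  bothNonEmpty? : (S : List (Fin n)) (a : List Bool) → Dec ((nonEmpty (T-side S a) ∧ nonEmpty (F-side S a)) ≡ true)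
  bothNonEmpty? S a = Bool._≟_ (nonEmpty (T-side S a) ∧ nonEmpty (F-side S a)) true

  valid : List (Fin n) → List (List Bool)
  valid S = filter (bothNonEmpty? S) (assignments (length S))

  valid⇒sizes : ∀ S a → a ∈ valid S → (length a ≡ length S) × (1 ℕ.≤ length (T-side S a)) × (1 ℕ.≤ length (F-side S a))
  valid⇒sizes S a a∈ with ∈-filter⁻ (bothNonEmpty? S) {xs = assignments (length S)} a∈
  ... | a∈asg , both = length-∈-assignments _ a a∈asg , nonEmpty⇒1≤ (T-side S a) (∧≡true⇒ˡ both) , nonEmpty⇒1≤ (F-side S a) (∧≡true⇒ʳ both)
    where
    nonEmpty⇒1≤ : ∀ L → nonEmpty L ≡ true → 1 ℕ.≤ length L
    nonEmpty⇒1≤ (_ ∷ _) _ = ℕ.s≤s ℕ.z≤n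

  1≤length-valid : ∀ x y zs → 1 ℕ.≤ length (valid (x ∷ y ∷ zs))
  1≤length-valid x y zs = ∈⇒1≤length (∈-filter⁺ (bothNonEmpty? S) {xs = assignments (length S)} split-x∣rest refl)
    where
    S = x ∷ y ∷ zs
    allFalse : ℕ → List Bool
    allFalse zero = []
    allFalse (suc m) = false ∷ allFalse m
    length-allFalse : ∀ m → length (allFalse m) ≡ m
    length-allFalse zero = refl
    length-allFalse (suc m) = cong suc (length-allFalse m)
    split-x∣rest : (true ∷ false ∷ allFalse (length zs)) ∈ assignments (length S)
    split-x∣rest = subst (λ l → (true ∷ false ∷ allFalse (length zs)) ∈ assignments (suc (suc l)))
                         (length-allFalse (length zs)) (∈-assignments (true ∷ false ∷ allFalse (length zs)))
    ∈⇒1≤length : ∀ {A : Set} {u : A} {L} → u ∈ L → 1 ℕ.≤ length L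
    ∈⇒1≤length (here _) = ℕ.s≤s ℕ.z≤n
    ∈⇒1≤length (there _) = ℕ.s≤s ℕ.z≤n

  length-sides-≤ : ∀ S a k → a ∈ valid S → length S ℕ.≤ suc k → (length (T-side S a) ℕ.≤ k) × (length (F-side S a) ℕ.≤ k)
  length-sides-≤ S a k a∈ S≤1+k with valid⇒sizes S a a∈
  ... | a-len , 1≤T , 1≤F =
    ℕₚ.≤-pred (ℕₚ.≤-trans (ℕₚ.≤-trans (ℕₚ.≤-reflexive (ℕₚ.+-comm 1 _)) (ℕₚ.+-monoʳ-≤ (length (T-side S a)) 1≤F)) T+F≤1+k) ,
    ℕₚ.≤-pred (ℕₚ.≤-trans (ℕₚ.+-monoˡ-≤ (length (F-side S a)) 1≤T) T+F≤1+k)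
    where
    T+F≤1+k : length (T-side S a) ℕ.+ length (F-side S a) ℕ.≤ suc k
    T+F≤1+k = ℕₚ.≤-trans (ℕₚ.≤-reflexive (length-sides S a a-len)) S≤1+k

-- Counting over all side assignments

module _ where
  open import Data.Nat using (_+_; _*_; _^_; _≤_; _<_; z≤n; s≤s)

  module _ {A : Set} where

    sum-map-cong-∈ : {f g : A → ℕ} (L : List A) → (∀ x → x ∈ L → f x ≡ g x) → sum (map f L) ≡ sum (map g L)
    sum-map-cong-∈ [] h = refl
    sum-map-cong-∈ (x ∷ L) h = cong₂ _+_ (h x (here refl)) (sum-map-cong-∈ L (λ y y∈L → h y (there y∈L)))

    sum-map-+ : (f g : A → ℕ) (L : List A) → sum (map (λ x → f x + g x) L) ≡ sum (map f L) + sum (map g L)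
    sum-map-+ f g [] = refl
    sum-map-+ f g (x ∷ L) rewrite sum-map-+ f g L = ℕ+.interchange (f x) (g x) (sum (map f L)) (sum (map g L))

    sum-map-*ˡ : (c : ℕ) (f : A → ℕ) (L : List A) → sum (map (λ x → c * f x) L) ≡ c * sum (map f L)
    sum-map-*ˡ c f [] = sym (ℕₚ.*-zeroʳ c)
    sum-map-*ˡ c f (x ∷ L) rewrite sum-map-*ˡ c f L = sym (ℕₚ.*-distribˡ-+ c (f x) _)

    sum-map-mono : {f g : A → ℕ} (L : List A) → (∀ x → x ∈ L → f x ≤ g x) → sum (map f L) ≤ sum (map g L)
    sum-map-mono [] h = z≤n
    sum-map-mono (x ∷ L) h = ℕₚ.+-mono-≤ (h x (here refl)) (sum-map-mono L (λ y y∈L → h y (there y∈L)))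

    sum-map-const : (c : ℕ) (L : List A) → sum (map (λ _ → c) L) ≡ length L * c
    sum-map-const c [] = refl
    sum-map-const c (x ∷ L) = cong (c +_) (sum-map-const c L)

    module _ {P : A → Set} (P? : (x : A) → Dec (P x)) where

      sum-map-filter-split : ∀ (f : A → ℕ) L → sum (map f L) ≡ sum (map f (filter P? L)) + sum (map f (filter (¬? ∘ P?) L))
      sum-map-filter-split f [] = refl
      sum-map-filter-split f (x ∷ L) with P? x
      ... | yes _ = trans (cong (f x +_) (sum-map-filter-split f L)) (sym (ℕₚ.+-assoc (f x) _ _))
      ... | no _ = trans (cong (f x +_) (sum-map-filter-split f L)) (ℕ+.x∙yz≈y∙xz (f x) (sum (map f (filter P? L))) (sum (map f (filter (¬? ∘ P?) L))))

      length-filter-split : ∀ L → length L ≡ length (filter P? L) + length (filter (¬? ∘ P?) L)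
      length-filter-split [] = refl
      length-filter-split (x ∷ L) with P? x
      ... | yes _ = cong suc (length-filter-split L)
      ... | no _ = trans (cong suc (length-filter-split L)) (sym (ℕₚ.+-suc _ _))

  module SplitCounting (n : ℕ) where
    open Instance n
    open Membership n
    open Splits n

    Σ[asg] : ℕ → (List Bool → ℕ) → ℕ
    Σ[asg] m f = sum (map f (assignments m))

    Σ[asg]-suc : ∀ m f → Σ[asg] (suc m) f ≡ Σ[asg] m (λ a → f (true ∷ a) + f (false ∷ a))
    Σ[asg]-suc m f = go (assignments m)
      where
      go : ∀ L → sum (map f (concatMap (λ a → (true ∷ a) ∷ (false ∷ a) ∷ []) L)) ≡ sum (map (λ a → f (true ∷ a) + f (false ∷ a)) L)
      go [] = refl
      go (a ∷ L) = trans (cong sum (Listₚ.map-++ f ((true ∷ a) ∷ (false ∷ a) ∷ []) (concatMap _ L)))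
        (trans (sum-++ (f (true ∷ a) ∷ f (false ∷ a) ∷ []) (map f (concatMap _ L)))
          (cong₂ _+_ (cong (f (true ∷ a) +_) (ℕₚ.+-identityʳ _)) (go L)))

    Σ[asg]-const : ∀ m c → Σ[asg] m (λ _ → c) ≡ 2 ^ m * c
    Σ[asg]-const zero c = trans (ℕₚ.+-identityʳ c) (sym (ℕₚ.*-identityˡ c))
    Σ[asg]-const (suc m) c = trans (Σ[asg]-suc m (λ _ → c)) (trans (Σ[asg]-const m (c + c)) (doubling (2 ^ m) c))
      where
      doubling : ∀ p c → p * (c + c) ≡ (2 * p) * c
      doubling = solve-∀

    length-assignments : ∀ m → length (assignments m) ≡ 2 ^ m
    length-assignments m = trans (sym (trans (sum-map-const 1 (assignments m)) (ℕₚ.*-identityʳ _)))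
                                 (trans (Σ[asg]-const m 1) (ℕₚ.*-identityʳ _))

    sideAt : List Bool → ℕ → Bool
    sideAt [] _ = false
    sideAt (c ∷ a) zero = c
    sideAt (c ∷ a) (suc p) = sideAt a p

    sameSide : Bool → Bool → Bool
    sameSide true true = true
    sameSide false false = true
    sameSide _ _ = false

    countSide : Bool → List Bool → ℕ
    countSide b [] = 0
    countSide b (c ∷ a) = if sameSide c b then suc (countSide b a) else countSide b a

    𝟙 : Bool → ℕ
    𝟙 b = if b then 1 else 0

    countSide-T+F : ∀ a → countSide true a + countSide false a ≡ length a
    countSide-T+F [] = refl
    countSide-T+F (true ∷ a) = cong suc (countSide-T+F a)
    countSide-T+F (false ∷ a) = trans (ℕₚ.+-suc _ _) (cong suc (countSide-T+F a))

    countSide-∷ : ∀ b a → countSide b (true ∷ a) + countSide b (false ∷ a) ≡ suc (2 * countSide b a)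
    countSide-∷ true a = cong suc (cong (countSide true a +_) (sym (ℕₚ.+-identityʳ _)))
    countSide-∷ false a = trans (ℕₚ.+-suc _ _) (cong suc (cong (countSide false a +_) (sym (ℕₚ.+-identityʳ _))))

    Σ[asg]-countSide : ∀ m q → q < m → 2 * Σ[asg] m (λ a → countSide (sideAt a q) a) ≡ 2 ^ m * (m + 1)
    Σ[asg]-countSide (suc m) zero _ = begin
        2 * Σ[asg] (suc m) (λ a → countSide (sideAt a 0) a)
      ≡⟨ cong (2 *_) (Σ[asg]-suc m _) ⟩
        2 * Σ[asg] m (λ a → suc (countSide true a) + suc (countSide false a))
      ≡⟨ cong (2 *_) (sum-map-cong-∈ (assignments m) (λ a a∈ →
           trans (cong suc (ℕₚ.+-suc _ _)) (cong (2 +_) (trans (countSide-T+F a) (length-∈-assignments m a a∈))))) ⟩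
        2 * Σ[asg] m (λ _ → 2 + m)
      ≡⟨ cong (2 *_) (Σ[asg]-const m (2 + m)) ⟩
        2 * (2 ^ m * (2 + m))
      ≡⟨ identity (2 ^ m) m ⟩
        2 ^ suc m * (suc m + 1)
      ∎
      where
      open ≡-Reasoning
      identity : ∀ p m → 2 * (p * (2 + m)) ≡ (2 * p) * ((1 + m) + 1)
      identity = solve-∀
    Σ[asg]-countSide (suc m) (suc q) (s≤s q<m) = begin
        2 * Σ[asg] (suc m) (λ a → countSide (sideAt a (suc q)) a)
      ≡⟨ cong (2 *_) (Σ[asg]-suc m _) ⟩
        2 * Σ[asg] m (λ a → countSide (sideAt a q) (true ∷ a) + countSide (sideAt a q) (false ∷ a))
      ≡⟨ cong (2 *_) (sum-map-cong-∈ (assignments m) (λ a _ → countSide-∷ (sideAt a q) a)) ⟩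
        2 * Σ[asg] m (λ a → 1 + 2 * countSide (sideAt a q) a)
      ≡⟨ cong (2 *_) (trans (sum-map-+ (λ _ → 1) _ (assignments m)) (cong₂ _+_ (Σ[asg]-const m 1) (sum-map-*ˡ 2 _ (assignments m)))) ⟩
        2 * (2 ^ m * 1 + 2 * Σ[asg] m (λ a → countSide (sideAt a q) a))
      ≡⟨ cong (λ x → 2 * (2 ^ m * 1 + x)) (Σ[asg]-countSide m q q<m) ⟩
        2 * (2 ^ m * 1 + 2 ^ m * (m + 1))
      ≡⟨ identity (2 ^ m) m ⟩
        2 ^ suc m * (suc m + 1)
      ∎
      where
      open ≡-Reasoning
      identity : ∀ p m → 2 * (p * 1 + p * (m + 1)) ≡ (2 * p) * ((1 + m) + 1)
      identity = solve-∀

    Σ[asg]-sameSide : ∀ m p q → p ≢ q → p < m → q < m → 2 * Σ[asg] m (λ a → 𝟙 (sameSide (sideAt a p) (sideAt a q))) ≡ 2 ^ m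
    Σ[asg]-sameSide (suc m) zero zero p≢q _ _ = ⊥-elim (p≢q refl)
    Σ[asg]-sameSide (suc m) zero (suc q) _ _ _ =
      trans (cong (2 *_) (trans (Σ[asg]-suc m _) (trans (sum-map-cong-∈ (assignments m) (λ a _ → one-of-two (sideAt a q))) (Σ[asg]-const m 1))))
            (cong (2 *_) (ℕₚ.*-identityʳ (2 ^ m)))
      where
      one-of-two : ∀ b → 𝟙 (sameSide true b) + 𝟙 (sameSide false b) ≡ 1
      one-of-two true = refl
      one-of-two false = refl
    Σ[asg]-sameSide (suc m) (suc p) zero _ _ _ =
      trans (cong (2 *_) (trans (Σ[asg]-suc m _) (trans (sum-map-cong-∈ (assignments m) (λ a _ → one-of-two (sideAt a p))) (Σ[asg]-const m 1))))
            (cong (2 *_) (ℕₚ.*-identityʳ (2 ^ m)))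
      where
      one-of-two : ∀ b → 𝟙 (sameSide b true) + 𝟙 (sameSide b false) ≡ 1
      one-of-two true = refl
      one-of-two false = refl
    Σ[asg]-sameSide (suc m) (suc p) (suc q) p≢q (s≤s p<m) (s≤s q<m) =
      trans (cong (2 *_) (trans (Σ[asg]-suc m _) (trans (sum-map-+ I I (assignments m)) (cong (Σ[asg] m I +_) (sym (ℕₚ.+-identityʳ (Σ[asg] m I)))))))
            (cong (2 *_) (Σ[asg]-sameSide m p q (λ e → p≢q (cong suc e)) p<m q<m))
      where
      I : List Bool → ℕ
      I a = 𝟙 (sameSide (sideAt a p) (sideAt a q))

    -- 3|T_{pq}| is bounded below by this cost: 2|side| if p, q stay together, 3|S| when they are separated
    splitCost : ℕ → ℕ → List Bool → ℕ
    splitCost p q a = if sameSide (sideAt a p) (sideAt a q) then 2 * countSide (sideAt a p) a else 3 * length a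

    splitCost-∷-head : ∀ b a → (if sameSide true b then 2 * countSide true (true ∷ a) else 3 * suc (length a))
                               + (if sameSide false b then 2 * countSide false (false ∷ a) else 3 * suc (length a))
                             ≡ 2 * countSide b a + (2 + 3 * suc (length a))
    splitCost-∷-head true a = identity (countSide true a) (length a)
      where
      identity : ∀ c l → 2 * (1 + c) + 3 * (1 + l) ≡ 2 * c + (2 + 3 * (1 + l))
      identity = solve-∀
    splitCost-∷-head false a = identity (countSide false a) (length a)
      where
      identity : ∀ c l → 3 * (1 + l) + 2 * (1 + c) ≡ 2 * c + (2 + 3 * (1 + l))
      identity = solve-∀

    splitCost-∷-head′ : ∀ b a → (if sameSide b true then 2 * countSide b (true ∷ a) else 3 * suc (length a))
                                + (if sameSide b false then 2 * countSide b (false ∷ a) else 3 * suc (length a))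
                              ≡ 2 * countSide b a + (2 + 3 * suc (length a))
    splitCost-∷-head′ true a = splitCost-∷-head true a
    splitCost-∷-head′ false a = splitCost-∷-head false a

    splitCost-∷-tail : ∀ e B a → (if e then 2 * countSide B (true ∷ a) else 3 * suc (length a))
                                 + (if e then 2 * countSide B (false ∷ a) else 3 * suc (length a)) + 4 * 𝟙 e
                               ≡ 2 * (if e then 2 * countSide B a else 3 * length a) + 6
    splitCost-∷-tail true B a = begin
        2 * countSide B (true ∷ a) + 2 * countSide B (false ∷ a) + 4 * 1
      ≡⟨ cong (_+ 4 * 1) (sym (ℕₚ.*-distribˡ-+ 2 (countSide B (true ∷ a)) (countSide B (false ∷ a)))) ⟩
        2 * (countSide B (true ∷ a) + countSide B (false ∷ a)) + 4 * 1
      ≡⟨ cong (λ x → 2 * x + 4 * 1) (countSide-∷ B a) ⟩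
        2 * suc (2 * countSide B a) + 4 * 1
      ≡⟨ identity (countSide B a) ⟩
        2 * (2 * countSide B a) + 6
      ∎
      where
      open ≡-Reasoning
      identity : ∀ c → 2 * (1 + 2 * c) + 4 * 1 ≡ 2 * (2 * c) + 6
      identity = solve-∀
    splitCost-∷-tail false B a = identity (length a)
      where
      identity : ∀ l → 3 * (1 + l) + 3 * (1 + l) + 4 * 0 ≡ 2 * (3 * l) + 6
      identity = solve-∀

    head-identity : ∀ p m → p * (m + 1) + p * (2 + 3 * (1 + m)) ≡ (2 * p) * (2 * (1 + m) + 1)
    head-identity = solve-∀

    Σ[asg]-splitCost : ∀ m p q → p ≢ q → p < m → q < m → Σ[asg] m (splitCost p q) ≡ 2 ^ m * (2 * m + 1)
    Σ[asg]-splitCost (suc m) zero zero p≢q _ _ = ⊥-elim (p≢q refl)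
    Σ[asg]-splitCost (suc m) zero (suc q) _ _ (s≤s q<m) = begin
        Σ[asg] (suc m) (splitCost 0 (suc q))
      ≡⟨ Σ[asg]-suc m _ ⟩
        Σ[asg] m (λ a → splitCost 0 (suc q) (true ∷ a) + splitCost 0 (suc q) (false ∷ a))
      ≡⟨ sum-map-cong-∈ (assignments m) (λ a a∈ → trans (splitCost-∷-head (sideAt a q) a)
           (cong (λ l → 2 * countSide (sideAt a q) a + (2 + 3 * suc l)) (length-∈-assignments m a a∈))) ⟩
        Σ[asg] m (λ a → 2 * countSide (sideAt a q) a + (2 + 3 * suc m))
      ≡⟨ trans (sum-map-+ _ _ (assignments m)) (cong₂ _+_ (sum-map-*ˡ 2 _ (assignments m)) (Σ[asg]-const m _)) ⟩
        2 * Σ[asg] m (λ a → countSide (sideAt a q) a) + 2 ^ m * (2 + 3 * suc m)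
      ≡⟨ cong (_+ 2 ^ m * (2 + 3 * suc m)) (Σ[asg]-countSide m q q<m) ⟩
        2 ^ m * (m + 1) + 2 ^ m * (2 + 3 * suc m)
      ≡⟨ head-identity (2 ^ m) m ⟩
        2 ^ suc m * (2 * suc m + 1)
      ∎
      where open ≡-Reasoning
    Σ[asg]-splitCost (suc m) (suc p) zero _ (s≤s p<m) _ = begin
        Σ[asg] (suc m) (splitCost (suc p) 0)
      ≡⟨ Σ[asg]-suc m _ ⟩
        Σ[asg] m (λ a → splitCost (suc p) 0 (true ∷ a) + splitCost (suc p) 0 (false ∷ a))
      ≡⟨ sum-map-cong-∈ (assignments m) (λ a a∈ → trans (splitCost-∷-head′ (sideAt a p) a)
           (cong (λ l → 2 * countSide (sideAt a p) a + (2 + 3 * suc l)) (length-∈-assignments m a a∈))) ⟩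
        Σ[asg] m (λ a → 2 * countSide (sideAt a p) a + (2 + 3 * suc m))
      ≡⟨ trans (sum-map-+ _ _ (assignments m)) (cong₂ _+_ (sum-map-*ˡ 2 _ (assignments m)) (Σ[asg]-const m _)) ⟩
        2 * Σ[asg] m (λ a → countSide (sideAt a p) a) + 2 ^ m * (2 + 3 * suc m)
      ≡⟨ cong (_+ 2 ^ m * (2 + 3 * suc m)) (Σ[asg]-countSide m p p<m) ⟩
        2 ^ m * (m + 1) + 2 ^ m * (2 + 3 * suc m)
      ≡⟨ head-identity (2 ^ m) m ⟩
        2 ^ suc m * (2 * suc m + 1)
      ∎
      where open ≡-Reasoning
    Σ[asg]-splitCost (suc m) (suc p) (suc q) p≢q (s≤s p<m) (s≤s q<m) = ℕₚ.+-cancelʳ-≡ (2 * 2 ^ m) _ _ (begin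
        Σ[asg] (suc m) (splitCost (suc p) (suc q)) + 2 * 2 ^ m
      ≡⟨ cong₂ _+_ (Σ[asg]-suc m _) (cong (2 *_) (sym (Σ[asg]-sameSide m p q (λ e → p≢q (cong suc e)) p<m q<m))) ⟩
        Σ[asg] m (λ a → splitCost (suc p) (suc q) (true ∷ a) + splitCost (suc p) (suc q) (false ∷ a)) + 2 * (2 * Σ[asg] m I)
      ≡⟨ cong (Σ[asg] m (λ a → splitCost (suc p) (suc q) (true ∷ a) + splitCost (suc p) (suc q) (false ∷ a)) +_)
              (trans (sym (ℕₚ.*-assoc 2 2 (Σ[asg] m I))) (sym (sum-map-*ˡ 4 I (assignments m)))) ⟩
        Σ[asg] m (λ a → splitCost (suc p) (suc q) (true ∷ a) + splitCost (suc p) (suc q) (false ∷ a)) + Σ[asg] m (λ a → 4 * I a)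
      ≡⟨ sym (sum-map-+ _ _ (assignments m)) ⟩
        Σ[asg] m (λ a → splitCost (suc p) (suc q) (true ∷ a) + splitCost (suc p) (suc q) (false ∷ a) + 4 * I a)
      ≡⟨ sum-map-cong-∈ (assignments m) (λ a _ → splitCost-∷-tail (sameSide (sideAt a p) (sideAt a q)) (sideAt a p) a) ⟩
        Σ[asg] m (λ a → 2 * splitCost p q a + 6)
      ≡⟨ trans (sum-map-+ _ _ (assignments m)) (cong₂ _+_ (sum-map-*ˡ 2 _ (assignments m)) (Σ[asg]-const m 6)) ⟩
        2 * Σ[asg] m (splitCost p q) + 2 ^ m * 6
      ≡⟨ cong (λ x → 2 * x + 2 ^ m * 6) (Σ[asg]-splitCost m p q (λ e → p≢q (cong suc e)) p<m q<m) ⟩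
        2 * (2 ^ m * (2 * m + 1)) + 2 ^ m * 6
      ≡⟨ tail-identity (2 ^ m) m ⟩
        2 ^ suc m * (2 * suc m + 1) + 2 * 2 ^ m
      ∎)
      where
      open ≡-Reasoning
      I : List Bool → ℕ
      I a = 𝟙 (sameSide (sideAt a p) (sideAt a q))
      tail-identity : ∀ p m → 2 * (p * (2 * m + 1)) + p * 6 ≡ (2 * p) * (2 * (1 + m) + 1) + 2 * p
      tail-identity = solve-∀

    sideCost : List (Fin n) → Fin n → Fin n → List Bool → ℕ
    sideCost S i j a = if mem i (T-side S a) ∧ mem j (T-side S a) then 2 * length (T-side S a)
                       else (if mem i (F-side S a) ∧ mem j (F-side S a) then 2 * length (F-side S a) else 3 * length S)

    position : Fin n → List (Fin n) → ℕ
    position x [] = 0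
    position x (u ∷ S) = if ⌊ x Fin.≟ u ⌋ then 0 else suc (position x S)

    position-< : ∀ x S → mem x S ≡ true → position x S < length S
    position-< x (u ∷ S) x∈S with x Fin.≟ u
    ... | yes _ = s≤s z≤n
    ... | no _ = s≤s (position-< x S x∈S)

    position-injective : ∀ i j S → mem i S ≡ true → mem j S ≡ true → i ≢ j → position i S ≢ position j S
    position-injective i j (u ∷ S) i∈S j∈S i≢j with i Fin.≟ u | j Fin.≟ u
    ... | yes refl | yes refl = λ _ → i≢j refl
    ... | yes _ | no _ = λ ()
    ... | no _ | yes _ = λ ()
    ... | no _ | no _ = λ e → position-injective i j S i∈S j∈S i≢j (ℕₚ.suc-injective e)

    mem-sideOf-∉ : ∀ x b S a → mem x S ≡ false → mem x (sideOf b S a) ≡ false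
    mem-sideOf-∉ x b S a x∉S with mem x (sideOf b S a) in x∈side
    ... | false = refl
    ... | true = trans (sym (mem-sideOf⇒mem x b S a x∈side)) x∉S

    mem-T-side : ∀ x S a → NoDup S → mem x S ≡ true → length a ≡ length S → mem x (T-side S a) ≡ sideAt a (position x S)
    mem-T-side x (u ∷ S) (true ∷ a) (u∉S , nd) x∈S e with x Fin.≟ u
    ... | yes refl = refl
    ... | no _ = mem-T-side x S a nd x∈S (ℕₚ.suc-injective e)
    mem-T-side x (u ∷ S) (false ∷ a) (u∉S , nd) x∈S e with x Fin.≟ u
    ... | yes refl = mem-sideOf-∉ x true S a u∉S
    ... | no _ = mem-T-side x S a nd x∈S (ℕₚ.suc-injective e)

    mem-F-side : ∀ x S a → NoDup S → mem x S ≡ true → length a ≡ length S → mem x (F-side S a) ≡ not (sideAt a (position x S))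
    mem-F-side x (u ∷ S) (false ∷ a) (u∉S , nd) x∈S e with x Fin.≟ u
    ... | yes refl = refl
    ... | no _ = mem-F-side x S a nd x∈S (ℕₚ.suc-injective e)
    mem-F-side x (u ∷ S) (true ∷ a) (u∉S , nd) x∈S e with x Fin.≟ u
    ... | yes refl = mem-sideOf-∉ x false S a u∉S
    ... | no _ = mem-F-side x S a nd x∈S (ℕₚ.suc-injective e)

    length-sideOf : ∀ b S a → length a ≡ length S → length (sideOf b S a) ≡ countSide b a
    length-sideOf b [] [] _ = refl
    length-sideOf b (u ∷ S) (c ∷ a) e with length-sideOf b S a (ℕₚ.suc-injective e)
    length-sideOf true (u ∷ S) (true ∷ a) e | ih = cong suc ih
    length-sideOf true (u ∷ S) (false ∷ a) e | ih = ih
    length-sideOf false (u ∷ S) (true ∷ a) e | ih = ih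
    length-sideOf false (u ∷ S) (false ∷ a) e | ih = cong suc ih

    sideCost≡splitCost : ∀ S i j a → NoDup S → mem i S ≡ true → mem j S ≡ true → length a ≡ length S →
      sideCost S i j a ≡ splitCost (position i S) (position j S) a
    sideCost≡splitCost S i j a nd i∈S j∈S e
      rewrite mem-T-side i S a nd i∈S e | mem-T-side j S a nd j∈S e | mem-F-side i S a nd i∈S e | mem-F-side j S a nd j∈S e
            | length-sideOf true S a e | length-sideOf false S a e | sym e
      with sideAt a (position i S) | sideAt a (position j S)
    ... | true | true = refl
    ... | true | false = refl
    ... | false | true = refl
    ... | false | false = refl

    sideCost-one-sided : ∀ i j m (T F : List (Fin n)) → (mem i T ∨ mem i F) ≡ true → (mem j T ∨ mem j F) ≡ true →
      length T ≤ m → length F ≤ m → (nonEmpty T ∧ nonEmpty F) ≢ true →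
      (if mem i T ∧ mem j T then 2 * length T else (if mem i F ∧ mem j F then 2 * length F else 3 * m)) ≤ 2 * m
    sideCost-one-sided i j m [] F i∈ j∈ _ F≤m _ rewrite i∈ | j∈ = ℕₚ.*-monoʳ-≤ 2 F≤m
    sideCost-one-sided i j m (t ∷ T) [] i∈ j∈ T≤m _ _
      rewrite trans (sym (Boolₚ.∨-identityʳ _)) i∈ | trans (sym (Boolₚ.∨-identityʳ _)) j∈ = ℕₚ.*-monoʳ-≤ 2 T≤m
    sideCost-one-sided i j m (t ∷ T) (f ∷ F) _ _ _ _ both = ⊥-elim (both refl)

    -- Summing sideCost over all 2^m assignments gives 2^m (2m + 1) ≥ 2m · 2^m; the one-sided assignments,
    -- which RP excludes, cost at most 2m each, so the valid ones cost at least 2m on average.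
    sum-valid-sideCost : ∀ S i j → NoDup S → i ≢ j → mem i S ≡ true → mem j S ≡ true →
      2 * length S * length (valid S) ≤ sum (map (sideCost S i j) (valid S))
    sum-valid-sideCost S i j nd i≢j i∈S j∈S = ℕₚ.+-cancelʳ-≤ (2 * m * length invalid) _ _ (begin
        2 * m * length (valid S) + 2 * m * length invalid
      ≡⟨ sym (ℕₚ.*-distribˡ-+ (2 * m) _ _) ⟩
        2 * m * (length (valid S) + length invalid)
      ≡⟨ cong (2 * m *_) (sym (length-filter-split (bothNonEmpty? S) (assignments m))) ⟩
        2 * m * length (assignments m)
      ≡⟨ cong (2 * m *_) (length-assignments m) ⟩
        2 * m * 2 ^ m
      ≤⟨ ℕₚ.≤-trans (ℕₚ.≤-reflexive (ℕₚ.*-comm (2 * m) (2 ^ m))) (ℕₚ.*-monoʳ-≤ (2 ^ m) (ℕₚ.n≤1+n (2 * m))) ⟩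
        2 ^ m * suc (2 * m)
      ≡⟨ cong (2 ^ m *_) (ℕₚ.+-comm 1 (2 * m)) ⟩
        2 ^ m * (2 * m + 1)
      ≡⟨ sym sum-all ⟩
        sum (map (sideCost S i j) (assignments m))
      ≡⟨ sum-map-filter-split (bothNonEmpty? S) (sideCost S i j) (assignments m) ⟩
        sum (map (sideCost S i j) (valid S)) + sum (map (sideCost S i j) invalid)
      ≤⟨ ℕₚ.+-monoʳ-≤ (sum (map (sideCost S i j) (valid S))) sum-invalid ⟩
        sum (map (sideCost S i j) (valid S)) + 2 * m * length invalid
      ∎)
      where
      open ℕₚ.≤-Reasoning
      m = length S
      invalid = filter (¬? ∘ bothNonEmpty? S) (assignments m)
      sum-all : sum (map (sideCost S i j) (assignments m)) ≡ 2 ^ m * (2 * m + 1)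
      sum-all = trans (sum-map-cong-∈ (assignments m) (λ a a∈ → sideCost≡splitCost S i j a nd i∈S j∈S (length-∈-assignments m a a∈)))
                      (Σ[asg]-splitCost m (position i S) (position j S) (position-injective i j S i∈S j∈S i≢j)
                                        (position-< i S i∈S) (position-< j S j∈S))
      invalid-≤ : ∀ a → a ∈ invalid → sideCost S i j a ≤ 2 * m
      invalid-≤ a a∈ with ∈-filter⁻ (¬? ∘ bothNonEmpty? S) {xs = assignments m} a∈
      ... | a∈asg , one-sided = sideCost-one-sided i j m (T-side S a) (F-side S a)
             (trans (sym (mem-sides i S a a-len)) i∈S) (trans (sym (mem-sides j S a a-len)) j∈S)
             (ℕₚ.≤-trans (ℕₚ.m≤m+n _ _) (ℕₚ.≤-reflexive (length-sides S a a-len)))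
             (ℕₚ.≤-trans (ℕₚ.m≤n+m _ _) (ℕₚ.≤-reflexive (length-sides S a a-len))) one-sided
        where a-len = length-∈-assignments m a a∈asg
      sum-invalid : sum (map (sideCost S i j) invalid) ≤ 2 * m * length invalid
      sum-invalid = ℕₚ.≤-trans (sum-map-mono invalid invalid-≤)
                               (ℕₚ.≤-reflexive (trans (sum-map-const (2 * m) invalid) (ℕₚ.*-comm (length invalid) (2 * m))))

open import Data.Rational hiding (floor; ceiling; truncate; round)
open import Data.Rational.Properties
import Data.Rational.Unnormalised as ℚᵘ
import Data.Rational.Unnormalised.Properties as ℚᵘₚ
open import Data.Rational.Solver
open +-*-Solver using (solve; _:+_; _:*_; _:-_; _:=_; con)

-- Rational arithmetic and finite sums

ℕ→ℚ≡mkℚ : ∀ k → ℕ→ℚ k ≡ mkℚ (ℤ.+ k) 0 (coprime-sym (1-coprimeTo k))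
ℕ→ℚ≡mkℚ k = normalize-coprime (coprime-sym (1-coprimeTo k))

ℕ→ℚ-suc : ∀ k → ℕ→ℚ (suc k) ≡ 1ℚ + ℕ→ℚ k
ℕ→ℚ-suc k = toℚᵘ-injective (begin-equality
    toℚᵘ (ℕ→ℚ (suc k))                ≃⟨ ℚᵘₚ.≃-reflexive (cong toℚᵘ (ℕ→ℚ≡mkℚ (suc k))) ⟩
    ℚᵘ.mkℚᵘ (ℤ.+ suc k) 0             ≃⟨ ℚᵘ.*≡* (suc≃1+ k) ⟩
    toℚᵘ 1ℚ ℚᵘ.+ ℚᵘ.mkℚᵘ (ℤ.+ k) 0    ≃⟨ ℚᵘₚ.≃-reflexive (cong (λ x → toℚᵘ 1ℚ ℚᵘ.+ toℚᵘ x) (sym (ℕ→ℚ≡mkℚ k))) ⟩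
    toℚᵘ 1ℚ ℚᵘ.+ toℚᵘ (ℕ→ℚ k)         ≃⟨ ℚᵘₚ.≃-sym (toℚᵘ-homo-+ 1ℚ (ℕ→ℚ k)) ⟩
    toℚᵘ (1ℚ + ℕ→ℚ k)                 ∎)
  where
  open ℚᵘₚ.≤-Reasoning
  suc≃1+ : ∀ k → ℤ.+ suc k ℤ.* ℤ.+ 1 ≡ ℚᵘ.↥ (toℚᵘ 1ℚ ℚᵘ.+ ℚᵘ.mkℚᵘ (ℤ.+ k) 0) ℤ.* ℤ.+ 1
  suc≃1+ zero = refl
  suc≃1+ (suc k) = cong (λ x → ℤ.+ suc (suc x)) (sym (ℕₚ.*-identityʳ _))

ℕ→ℚ-+ : ∀ a b → ℕ→ℚ (a ℕ.+ b) ≡ ℕ→ℚ a + ℕ→ℚ b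
ℕ→ℚ-+ zero b = sym (+-identityˡ (ℕ→ℚ b))
ℕ→ℚ-+ (suc a) b = begin
  ℕ→ℚ (suc (a ℕ.+ b))       ≡⟨ ℕ→ℚ-suc (a ℕ.+ b) ⟩
  1ℚ + ℕ→ℚ (a ℕ.+ b)        ≡⟨ cong (1ℚ +_) (ℕ→ℚ-+ a b) ⟩
  1ℚ + (ℕ→ℚ a + ℕ→ℚ b)      ≡⟨ +-assoc 1ℚ (ℕ→ℚ a) (ℕ→ℚ b) ⟨
  (1ℚ + ℕ→ℚ a) + ℕ→ℚ b      ≡⟨ cong (_+ ℕ→ℚ b) (ℕ→ℚ-suc a) ⟨
  ℕ→ℚ (suc a) + ℕ→ℚ b       ∎
  where open ≡-Reasoning

ℕ→ℚ-* : ∀ a b → ℕ→ℚ (a ℕ.* b) ≡ ℕ→ℚ a * ℕ→ℚ b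
ℕ→ℚ-* zero b = sym (*-zeroˡ (ℕ→ℚ b))
ℕ→ℚ-* (suc a) b = begin
  ℕ→ℚ (b ℕ.+ a ℕ.* b)           ≡⟨ ℕ→ℚ-+ b (a ℕ.* b) ⟩
  ℕ→ℚ b + ℕ→ℚ (a ℕ.* b)         ≡⟨ cong (ℕ→ℚ b +_) (ℕ→ℚ-* a b) ⟩
  ℕ→ℚ b + ℕ→ℚ a * ℕ→ℚ b         ≡⟨ solve 2 (λ a b → b :+ a :* b := (con 1ℚ :+ a) :* b) refl (ℕ→ℚ a) (ℕ→ℚ b) ⟩
  (1ℚ + ℕ→ℚ a) * ℕ→ℚ b          ≡⟨ cong (_* ℕ→ℚ b) (ℕ→ℚ-suc a) ⟨
  ℕ→ℚ (suc a) * ℕ→ℚ b           ∎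
  where open ≡-Reasoning

0≤1 : 0ℚ ≤ 1ℚ
0≤1 = *≤* (ℤ.+≤+ ℕ.z≤n)

+-pres-0≤ : ∀ {p q} → 0ℚ ≤ p → 0ℚ ≤ q → 0ℚ ≤ p + q
+-pres-0≤ 0≤p 0≤q = ≤-trans (≤-reflexive (sym (+-identityˡ 0ℚ))) (+-mono-≤ 0≤p 0≤q)

*-pres-0≤ : ∀ {p q} → 0ℚ ≤ p → 0ℚ ≤ q → 0ℚ ≤ p * q
*-pres-0≤ {p} 0≤p 0≤q = ≤-trans (≤-reflexive (sym (*-zeroʳ p))) (*-monoˡ-≤-nonNeg p {{nonNegative 0≤p}} 0≤q)

*-monoˡ-≤-0≤ : ∀ {r p q} → 0ℚ ≤ r → p ≤ q → r * p ≤ r * q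
*-monoˡ-≤-0≤ {r} 0≤r = *-monoˡ-≤-nonNeg r {{nonNegative 0≤r}}

*-cancelˡ-≤-0< : ∀ {r p q} → 0ℚ < r → r * p ≤ r * q → p ≤ q
*-cancelˡ-≤-0< {r} 0<r = *-cancelˡ-≤-pos r {{positive 0<r}}

0≤ℕ→ℚ : ∀ k → 0ℚ ≤ ℕ→ℚ k
0≤ℕ→ℚ zero = ≤-refl
0≤ℕ→ℚ (suc k) = ≤-trans (+-pres-0≤ 0≤1 (0≤ℕ→ℚ k)) (≤-reflexive (sym (ℕ→ℚ-suc k)))

0<ℕ→ℚ-suc : ∀ k → 0ℚ < ℕ→ℚ (suc k)
0<ℕ→ℚ-suc k = <-≤-trans (*<* (ℤ.+<+ (ℕ.s≤s ℕ.z≤n)))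
  (≤-trans (≤-reflexive (sym (+-identityʳ 1ℚ)))
    (≤-trans (+-monoʳ-≤ 1ℚ (0≤ℕ→ℚ k)) (≤-reflexive (sym (ℕ→ℚ-suc k)))))

0≤q-p⇒p≤q : ∀ {p q} → 0ℚ ≤ q - p → p ≤ q
0≤q-p⇒p≤q {p} {q} 0≤q-p = ≤-trans (≤-reflexive (sym (+-identityˡ p)))
  (≤-trans (+-monoˡ-≤ p 0≤q-p) (≤-reflexive (solve 2 (λ p q → (q :- p) :+ p := q) refl p q)))

p≤q⇒0≤q-p : ∀ {p q} → p ≤ q → 0ℚ ≤ q - p
p≤q⇒0≤q-p {p} p≤q = ≤-trans (≤-reflexive (sym (+-inverseʳ p))) (+-monoˡ-≤ (- p) p≤q)

ℕ→ℚ-mono-≤ : ∀ {a b} → a ℕ.≤ b → ℕ→ℚ a ≤ ℕ→ℚ b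
ℕ→ℚ-mono-≤ {a} a≤b with ℕₚ.m≤n⇒∃[o]m+o≡n a≤b
... | d , refl = 0≤q-p⇒p≤q (≤-trans (0≤ℕ→ℚ d) (≤-reflexive (trans
  (solve 2 (λ a d → d := (a :+ d) :- a) refl (ℕ→ℚ a) (ℕ→ℚ d)) (cong (_- ℕ→ℚ a) (sym (ℕ→ℚ-+ a d))))))

0<⇒≢0 : ∀ {p} → 0ℚ < p → p ≢ 0ℚ
0<⇒≢0 0<p refl = <-irrefl refl 0<p

*-÷'-cancel : ∀ p q → q ≢ 0ℚ → q * (p ÷' q) ≡ p
*-÷'-cancel p q q≢0 with q ≟ 0ℚ
... | yes q≡0 = ⊥-elim (q≢0 q≡0)
... | no q≢0′ = begin
  q * (p * 1/q)        ≡⟨ solve 3 (λ q p r → q :* (p :* r) := p :* (q :* r)) refl q p 1/q ⟩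
  p * (q * 1/q)        ≡⟨ cong (p *_) (*-inverseʳ q {{≢-nonZero q≢0′}}) ⟩
  p * 1ℚ               ≡⟨ *-identityʳ p ⟩
  p                    ∎
  where
  open ≡-Reasoning
  1/q = 1/_ q {{≢-nonZero q≢0′}}

sumℚ-++ : (xs ys : List ℚ) → sumℚ (xs ++ ys) ≡ sumℚ xs + sumℚ ys
sumℚ-++ [] ys = sym (+-identityˡ _)
sumℚ-++ (x ∷ xs) ys = trans (cong (x +_) (sumℚ-++ xs ys)) (sym (+-assoc x _ _))

module _ {A : Set} where

  sumℚ-map-cong-∈ : {f g : A → ℚ} (L : List A) → (∀ x → x ∈ L → f x ≡ g x) → sumℚ (map f L) ≡ sumℚ (map g L)
  sumℚ-map-cong-∈ [] h = refl
  sumℚ-map-cong-∈ (x ∷ L) h = cong₂ _+_ (h x (here refl)) (sumℚ-map-cong-∈ L (λ y y∈L → h y (there y∈L)))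

  sumℚ-map-cong : {f g : A → ℚ} (L : List A) → (∀ x → f x ≡ g x) → sumℚ (map f L) ≡ sumℚ (map g L)
  sumℚ-map-cong L h = sumℚ-map-cong-∈ L (λ x _ → h x)

  sumℚ-map-+ : (f g : A → ℚ) (L : List A) → sumℚ (map (λ x → f x + g x) L) ≡ sumℚ (map f L) + sumℚ (map g L)
  sumℚ-map-+ f g [] = refl
  sumℚ-map-+ f g (x ∷ L) = trans (cong (f x + g x +_) (sumℚ-map-+ f g L))
    (solve 4 (λ a b c d → (a :+ b) :+ (c :+ d) := (a :+ c) :+ (b :+ d)) refl (f x) (g x) (sumℚ (map f L)) (sumℚ (map g L)))

  sumℚ-map-*ˡ : (c : ℚ) (f : A → ℚ) (L : List A) → sumℚ (map (λ x → c * f x) L) ≡ c * sumℚ (map f L)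
  sumℚ-map-*ˡ c f [] = sym (*-zeroʳ c)
  sumℚ-map-*ˡ c f (x ∷ L) = trans (cong (c * f x +_) (sumℚ-map-*ˡ c f L)) (sym (*-distribˡ-+ c (f x) _))

  sumℚ-map-*ʳ : (c : ℚ) (f : A → ℚ) (L : List A) → sumℚ (map (λ x → f x * c) L) ≡ sumℚ (map f L) * c
  sumℚ-map-*ʳ c f [] = sym (*-zeroˡ c)
  sumℚ-map-*ʳ c f (x ∷ L) = trans (cong (f x * c +_) (sumℚ-map-*ʳ c f L)) (sym (*-distribʳ-+ c (f x) _))

  sumℚ-map-0 : (L : List A) → sumℚ (map (λ _ → 0ℚ) L) ≡ 0ℚ
  sumℚ-map-0 [] = refl
  sumℚ-map-0 (x ∷ L) = trans (+-identityˡ _) (sumℚ-map-0 L)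

  sumℚ-map-const : (c : ℚ) (L : List A) → sumℚ (map (λ _ → c) L) ≡ ℕ→ℚ (length L) * c
  sumℚ-map-const c [] = sym (*-zeroˡ c)
  sumℚ-map-const c (x ∷ L) = begin
    c + sumℚ (map (λ _ → c) L)     ≡⟨ cong (c +_) (sumℚ-map-const c L) ⟩
    c + ℕ→ℚ (length L) * c         ≡⟨ solve 2 (λ c l → c :+ l :* c := (con 1ℚ :+ l) :* c) refl c (ℕ→ℚ (length L)) ⟩
    (1ℚ + ℕ→ℚ (length L)) * c      ≡⟨ cong (_* c) (ℕ→ℚ-suc (length L)) ⟨
    ℕ→ℚ (suc (length L)) * c       ∎
    where open ≡-Reasoning

  sumℚ-map-mono : {f g : A → ℚ} (L : List A) → (∀ x → x ∈ L → f x ≤ g x) → sumℚ (map f L) ≤ sumℚ (map g L)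
  sumℚ-map-mono [] h = ≤-refl
  sumℚ-map-mono (x ∷ L) h = +-mono-≤ (h x (here refl)) (sumℚ-map-mono L (λ y y∈L → h y (there y∈L)))

  sumℚ-map-if : ∀ b (f : A → ℚ) (L : List A) → sumℚ (map (λ x → if b then f x else 0ℚ) L) ≡ (if b then sumℚ (map f L) else 0ℚ)
  sumℚ-map-if true f L = refl
  sumℚ-map-if false f L = sumℚ-map-0 L

module _ {A B : Set} where

  sumℚ-map-map : (g : B → ℚ) (f : A → B) (L : List A) → sumℚ (map g (map f L)) ≡ sumℚ (map (λ x → g (f x)) L)
  sumℚ-map-map g f L = cong sumℚ (sym (Listₚ.map-∘ L))

  sumℚ-map-concatMap : (g : B → ℚ) (f : A → List B) (L : List A) →
    sumℚ (map g (concatMap f L)) ≡ sumℚ (map (λ x → sumℚ (map g (f x))) L)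
  sumℚ-map-concatMap g f [] = refl
  sumℚ-map-concatMap g f (x ∷ L) = begin
    sumℚ (map g (f x ++ concatMap f L))                        ≡⟨ cong sumℚ (Listₚ.map-++ g (f x) (concatMap f L)) ⟩
    sumℚ (map g (f x) ++ map g (concatMap f L))                ≡⟨ sumℚ-++ (map g (f x)) (map g (concatMap f L)) ⟩
    sumℚ (map g (f x)) + sumℚ (map g (concatMap f L))          ≡⟨ cong (sumℚ (map g (f x)) +_) (sumℚ-map-concatMap g f L) ⟩
    sumℚ (map g (f x)) + sumℚ (map (λ x → sumℚ (map g (f x))) L) ∎
    where open ≡-Reasoning

sumℚ-allFin-suc : ∀ {n} (f : Fin (suc n) → ℚ) →
  sumℚ (map f (allFin (suc n))) ≡ f Fin.zero + sumℚ (map (λ u → f (Fin.suc u)) (allFin n))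
sumℚ-allFin-suc {n} f = cong (f Fin.zero +_) (trans (cong sumℚ (Listₚ.map-tabulate Fin.suc f))
  (cong sumℚ (sym (Listₚ.map-tabulate (λ x → x) (λ u → f (Fin.suc u))))))

sumℚ-allFin-≟ : ∀ {n} (v : Fin n) (f : Fin n → ℚ) → sumℚ (map (λ u → if ⌊ u Fin.≟ v ⌋ then f u else 0ℚ) (allFin n)) ≡ f v
sumℚ-allFin-≟ {suc n} Fin.zero f = trans (sumℚ-allFin-suc (λ u → if ⌊ u Fin.≟ Fin.zero ⌋ then f u else 0ℚ)) (trans (cong (f Fin.zero +_) (sumℚ-map-0 (allFin n))) (+-identityʳ _))
sumℚ-allFin-≟ {suc n} (Fin.suc v) f = trans (sumℚ-allFin-suc (λ u → if ⌊ u Fin.≟ Fin.suc v ⌋ then f u else 0ℚ))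
  (trans (+-identityˡ _) (trans (sumℚ-map-cong (allFin n) suc-≟) (sumℚ-allFin-≟ v (λ u → f (Fin.suc u)))))
  where
  suc-≟ : ∀ u → (if ⌊ Fin.suc u Fin.≟ Fin.suc v ⌋ then f (Fin.suc u) else 0ℚ) ≡ (if ⌊ u Fin.≟ v ⌋ then f (Fin.suc u) else 0ℚ)
  suc-≟ u with u Fin.≟ v
  ... | yes refl = refl
  ... | no _ = refl

<ᵇ≡true⇒< : ∀ {m n} → (m <ᵇ n) ≡ true → m ℕ.< n
<ᵇ≡true⇒< {zero} {suc n} _ = ℕ.s≤s ℕ.z≤n
<ᵇ≡true⇒< {suc m} {suc n} p = ℕ.s≤s (<ᵇ≡true⇒< p)

<⇒<ᵇ≡true : ∀ {m n} → m ℕ.< n → (m <ᵇ n) ≡ true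
<⇒<ᵇ≡true {zero} {suc n} _ = refl
<⇒<ᵇ≡true {suc m} {suc n} (ℕ.s≤s m<n) = <⇒<ᵇ≡true m<n

≥⇒<ᵇ≡false : ∀ {m n} → n ℕ.≤ m → (m <ᵇ n) ≡ false
≥⇒<ᵇ≡false {m} {zero} _ = refl
≥⇒<ᵇ≡false {suc m} {suc n} (ℕ.s≤s n≤m) = ≥⇒<ᵇ≡false n≤m

if-0-+ : ∀ b (x y : ℚ) → (if b then x else 0ℚ) + (if b then y else 0ℚ) ≡ (if b then x + y else 0ℚ)
if-0-+ true x y = refl
if-0-+ false x y = +-identityˡ 0ℚ

*-if-0 : ∀ b (c x : ℚ) → c * (if b then x else 0ℚ) ≡ (if b then c * x else 0ℚ)
*-if-0 true c x = refl
*-if-0 false c x = *-zeroʳ c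

module PairSums (n : ℕ) where
  open Instance n

  Pair : Fin n → Fin n → Set
  Pair i j = toℕ i ℕ.< toℕ j

  restrict : (Fin n → Fin n → ℚ) → Fin n → Fin n → ℚ
  restrict f i j = if toℕ i <ᵇ toℕ j then f i j else 0ℚ

  restrict-cong : ∀ {f g} (R : ℚ → ℚ → Set) → (∀ {x} → R x x) → (∀ i j → Pair i j → R (f i j) (g i j)) →
    ∀ i j → R (restrict f i j) (restrict g i j)
  restrict-cong R R-refl h i j with toℕ i <ᵇ toℕ j in eq
  ... | true = h i j (<ᵇ≡true⇒< eq)
  ... | false = R-refl

  sumPairs-cong : ∀ {f g} → (∀ i j → Pair i j → f i j ≡ g i j) → sumPairs f ≡ sumPairs g
  sumPairs-cong h = sumℚ-map-cong (allFin n) λ i → sumℚ-map-cong (allFin n) (restrict-cong _≡_ refl h i)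

  sumPairs-mono : ∀ {f g} → (∀ i j → Pair i j → f i j ≤ g i j) → sumPairs f ≤ sumPairs g
  sumPairs-mono h = sumℚ-map-mono (allFin n) λ i _ → sumℚ-map-mono (allFin n) λ j _ → restrict-cong _≤_ ≤-refl h i j

  sumPairs-+ : ∀ f g → sumPairs (λ i j → f i j + g i j) ≡ sumPairs f + sumPairs g
  sumPairs-+ f g = trans (sumℚ-map-cong (allFin n) (λ i →
      trans (sumℚ-map-cong (allFin n) (λ j → sym (if-0-+ (toℕ i <ᵇ toℕ j) (f i j) (g i j)))) (sumℚ-map-+ _ _ (allFin n))))
    (sumℚ-map-+ _ _ (allFin n))

  sumPairs-*ˡ : ∀ c f → sumPairs (λ i j → c * f i j) ≡ c * sumPairs f
  sumPairs-*ˡ c f = trans (sumℚ-map-cong (allFin n) (λ i →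
      trans (sumℚ-map-cong (allFin n) (λ j → sym (*-if-0 (toℕ i <ᵇ toℕ j) c (f i j)))) (sumℚ-map-*ˡ c _ (allFin n))))
    (sumℚ-map-*ˡ c _ (allFin n))

  sumPairs-0 : sumPairs (λ _ _ → 0ℚ) ≡ 0ℚ
  sumPairs-0 = trans (sumPairs-cong (λ _ _ _ → sym (*-zeroˡ 1ℚ))) (trans (sumPairs-*ˡ 0ℚ (λ _ _ → 1ℚ)) (*-zeroˡ (sumPairs (λ _ _ → 1ℚ))))

  sumPairs-nonNeg : ∀ {f} → (∀ i j → Pair i j → 0ℚ ≤ f i j) → 0ℚ ≤ sumPairs f
  sumPairs-nonNeg h = ≤-trans (≤-reflexive (sym sumPairs-0)) (sumPairs-mono h)

  sumℚ-sumPairs-comm : {X : Set} (D : List X) (c : X → ℚ) (G : X → Fin n → Fin n → ℚ) →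
    sumℚ (map (λ x → c x * sumPairs (G x)) D) ≡ sumPairs (λ i j → sumℚ (map (λ x → c x * G x i j) D))
  sumℚ-sumPairs-comm [] c G = sym sumPairs-0
  sumℚ-sumPairs-comm (x ∷ D) c G = begin
    c x * sumPairs (G x) + sumℚ (map (λ x → c x * sumPairs (G x)) D)
      ≡⟨ cong₂ _+_ (sumPairs-*ˡ (c x) (G x)) (sym (sumℚ-sumPairs-comm D c G)) ⟨
    sumPairs (λ i j → c x * G x i j) + sumPairs (λ i j → sumℚ (map (λ x → c x * G x i j) D))
      ≡⟨ sumPairs-+ _ _ ⟨
    sumPairs (λ i j → sumℚ (map (λ x → c x * G x i j) (x ∷ D)))
      ∎
    where open ≡-Reasoning

  sumPairs-incident : ∀ g → (∀ i j → g i j ≡ g j i) → ∀ v →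
    sumPairs (λ i j → if ⌊ i Fin.≟ v ⌋ ∨ ⌊ j Fin.≟ v ⌋ then g i j else 0ℚ)
      ≡ sumℚ (map (λ u → if ⌊ u Fin.≟ v ⌋ then 0ℚ else g v u) (allFin n))
  sumPairs-incident g g-sym v = begin
      sumPairs (λ i j → if ⌊ i Fin.≟ v ⌋ ∨ ⌊ j Fin.≟ v ⌋ then g i j else 0ℚ)
    ≡⟨ sumℚ-map-cong (allFin n) (λ i → trans (sumℚ-map-cong (allFin n) (split i)) (sumℚ-map-+ _ _ (allFin n))) ⟩
      sumℚ (map (λ i → sumℚ (map (λ j → if ⌊ i Fin.≟ v ⌋ then X i j else 0ℚ) (allFin n))
                      + sumℚ (map (λ j → if ⌊ j Fin.≟ v ⌋ then X i j else 0ℚ) (allFin n))) (allFin n))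
    ≡⟨ sumℚ-map-+ _ _ (allFin n) ⟩
      sumℚ (map (λ i → sumℚ (map (λ j → if ⌊ i Fin.≟ v ⌋ then X i j else 0ℚ) (allFin n))) (allFin n))
      + sumℚ (map (λ i → sumℚ (map (λ j → if ⌊ j Fin.≟ v ⌋ then X i j else 0ℚ) (allFin n))) (allFin n))
    ≡⟨ cong₂ _+_
         (trans (sumℚ-map-cong (allFin n) (λ i → sumℚ-map-if ⌊ i Fin.≟ v ⌋ (X i) (allFin n)))
                (sumℚ-allFin-≟ v (λ i → sumℚ (map (X i) (allFin n)))))
         (sumℚ-map-cong (allFin n) (λ i → sumℚ-allFin-≟ v (X i))) ⟩
      sumℚ (map (X v) (allFin n)) + sumℚ (map (λ u → X u v) (allFin n))
    ≡⟨ sumℚ-map-+ _ _ (allFin n) ⟨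
      sumℚ (map (λ u → X v u + X u v) (allFin n))
    ≡⟨ sumℚ-map-cong (allFin n) both-orders ⟩
      sumℚ (map (λ u → if ⌊ u Fin.≟ v ⌋ then 0ℚ else g v u) (allFin n))
    ∎
    where
    open ≡-Reasoning
    X = restrict g
    split : ∀ i j → restrict (λ i j → if ⌊ i Fin.≟ v ⌋ ∨ ⌊ j Fin.≟ v ⌋ then g i j else 0ℚ) i j
                   ≡ (if ⌊ i Fin.≟ v ⌋ then X i j else 0ℚ) + (if ⌊ j Fin.≟ v ⌋ then X i j else 0ℚ)
    split i j with i Fin.≟ v | j Fin.≟ v
    ... | yes refl | yes refl rewrite ≥⇒<ᵇ≡false {toℕ i} {toℕ i} ℕₚ.≤-refl = refl
    ... | yes _ | no _ = sym (+-identityʳ _)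
    ... | no _ | yes _ = sym (+-identityˡ _)
    ... | no _ | no _ with toℕ i <ᵇ toℕ j
    ... | true = refl
    ... | false = refl
    both-orders : ∀ u → X v u + X u v ≡ (if ⌊ u Fin.≟ v ⌋ then 0ℚ else g v u)
    both-orders u with u Fin.≟ v
    ... | yes refl rewrite ≥⇒<ᵇ≡false {toℕ u} {toℕ u} ℕₚ.≤-refl = refl
    ... | no u≢v with ℕₚ.<-cmp (toℕ v) (toℕ u)
    ... | tri< v<u _ _ rewrite <⇒<ᵇ≡true v<u | ≥⇒<ᵇ≡false {toℕ u} {toℕ v} (ℕₚ.<⇒≤ v<u) = +-identityʳ _
    ... | tri≈ _ v≡u _ = ⊥-elim (u≢v (Finₚ.toℕ-injective (sym v≡u)))
    ... | tri> _ _ u<v rewrite <⇒<ᵇ≡true u<v | ≥⇒<ᵇ≡false {toℕ v} {toℕ u} (ℕₚ.<⇒≤ u<v) = trans (+-identityˡ _) (g-sym u v)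

-- The peel-off phase

weightedSum : (ℕ → ℚ) → List ℚ → ℚ
weightedSum c [] = 0ℚ
weightedSum c (a ∷ as) = a * c 0 + weightedSum (λ t → c (suc t)) as

weightedSum-1 : ∀ as → weightedSum (λ _ → 1ℚ) as ≡ sumℚ as
weightedSum-1 [] = refl
weightedSum-1 (a ∷ as) = cong₂ _+_ (*-identityʳ a) (weightedSum-1 as)

-- eI, eJ : "i (resp. j) is the vertex v peeled now"; rI, rJ : "already peeled"; pI, pJ : "peeled later".
first-peeled-split : ∀ (eI eJ rI rJ pI pJ : Bool) (x : ℚ) (c : ℕ → ℚ) (k : ℕ) →
  (eI ∧ rI) ≡ false → (eJ ∧ rJ) ≡ false → (eI ∧ eJ) ≡ false →
  (if not rI ∧ not rJ ∧ ((eI ∨ pI) ∨ (eJ ∨ pJ)) then x * c (if eI ∨ eJ then 0 else suc k) else 0ℚ)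
  ≡ (if eI ∨ eJ then (if not rI ∧ not rJ then x * c 0 else 0ℚ) else 0ℚ)
    + (if not (rI ∨ eI) ∧ not (rJ ∨ eJ) ∧ (pI ∨ pJ) then x * c (suc k) else 0ℚ)
first-peeled-split true true _ _ _ _ x c k _ _ ()
first-peeled-split true false true _ _ _ x c k () _ _
first-peeled-split false true _ true _ _ x c k _ () _
first-peeled-split true false false false pI pJ x c k _ _ _ = sym (+-identityʳ _)
first-peeled-split true false false true pI pJ x c k _ _ _ = sym (+-identityʳ _)
first-peeled-split false true false false true pJ x c k _ _ _ = sym (+-identityʳ _)
first-peeled-split false true false false false pJ x c k _ _ _ = sym (+-identityʳ _)
first-peeled-split false true true false true pJ x c k _ _ _ = sym (+-identityʳ _)
first-peeled-split false true true false false pJ x c k _ _ _ = sym (+-identityʳ _)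
first-peeled-split false false false false pI pJ x c k _ _ _ = sym (+-identityˡ _)
first-peeled-split false false false true pI pJ x c k _ _ _ = sym (+-identityˡ _)
first-peeled-split false false true false pI pJ x c k _ _ _ = sym (+-identityˡ _)
first-peeled-split false false true true pI pJ x c k _ _ _ = sym (+-identityˡ _)

module PeelOffPhase (n : ℕ) (w : Fin n → Fin n → ℚ) (γ : ℚ) (w-sym : ∀ i j → w i j ≡ w j i) where
  open Instance n
  open PairSums n
  open Membership n

  peelDegrees : List (Fin n) → List (Fin n) → List ℚ
  peelDegrees R [] = []
  peelDegrees R (v ∷ vs) = Wv w R v ∷ peelDegrees (R ++ [ v ]) vs

  length-peelDegrees : ∀ R P → length (peelDegrees R P) ≡ length P
  length-peelDegrees R [] = refl
  length-peelDegrees R (v ∷ vs) = cong suc (length-peelDegrees (R ++ [ v ]) vs)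

  peeledCost : List (Fin n) → List (Fin n) → (ℕ → ℚ) → Fin n → Fin n → ℚ
  peeledCost R P c i j = if not (mem i R) ∧ not (mem j R) ∧ (mem i P ∨ mem j P) then w i j * c (firstHit P i j) else 0ℚ

  peelOff-disjoint : ∀ {R P} → PeelOff w γ R P → ∀ u → mem u P ≡ true → mem u R ≡ false
  peelOff-disjoint (stop _) u ()
  peelOff-disjoint {R} (step v rest v∉R _ _ po) u u∈P with u Fin.≟ v
  ... | yes refl = v∉R
  ... | no _ = ∨≡false⇒ˡ (trans (sym (mem-snoc u R v)) (peelOff-disjoint po u u∈P))

  peelOff-noDup : ∀ {R P} → PeelOff w γ R P → NoDup P
  peelOff-noDup (stop _) = tt
  peelOff-noDup {R} (step v rest _ _ _ po) with mem v rest in v∈rest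
  ... | false = refl , peelOff-noDup po
  ... | true with trans (sym (peelOff-disjoint po v v∈rest)) (trans (mem-snoc v R v) (trans (cong (mem v R ∨_) (≟-refl v)) (Boolₚ.∨-zeroʳ _)))
  ...   | ()

  sumPairs-peeledCost : ∀ {R P} → PeelOff w γ R P → ∀ c → sumPairs (peeledCost R P c) ≡ weightedSum c (peelDegrees R P)
  sumPairs-peeledCost {R} (stop _) c = trans (sumPairs-cong (λ i j _ → none i j)) sumPairs-0
    where
    none : ∀ i j → peeledCost R [] c i j ≡ 0ℚ
    none i j with not (mem i R) | not (mem j R)
    ... | true | true = refl
    ... | true | false = refl
    ... | false | _ = refl
  sumPairs-peeledCost {R} (step v vs v∉R _ _ po) c = begin
      sumPairs (peeledCost R (v ∷ vs) c)
    ≡⟨ sumPairs-cong split ⟩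
      sumPairs (λ i j → A i j + peeledCost (R ++ [ v ]) vs c′ i j)
    ≡⟨ sumPairs-+ A _ ⟩
      sumPairs A + sumPairs (peeledCost (R ++ [ v ]) vs c′)
    ≡⟨ cong₂ _+_ sumPairs-A (sumPairs-peeledCost po c′) ⟩
      Wv w R v * c 0 + weightedSum c′ (peelDegrees (R ++ [ v ]) vs)
    ∎
    where
    open ≡-Reasoning
    c′ : ℕ → ℚ
    c′ t = c (suc t)
    G : Fin n → Fin n → ℚ
    G i j = if not (mem i R) ∧ not (mem j R) then w i j * c 0 else 0ℚ
    A : Fin n → Fin n → ℚ
    A i j = if ⌊ i Fin.≟ v ⌋ ∨ ⌊ j Fin.≟ v ⌋ then G i j else 0ℚ
    is-v-not-in-R : ∀ i → (⌊ i Fin.≟ v ⌋ ∧ mem i R) ≡ false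
    is-v-not-in-R i with i Fin.≟ v
    ... | yes refl = v∉R
    ... | no _ = refl
    not-both-v : ∀ i j → Pair i j → (⌊ i Fin.≟ v ⌋ ∧ ⌊ j Fin.≟ v ⌋) ≡ false
    not-both-v i j i<j with i Fin.≟ v | j Fin.≟ v
    ... | yes refl | yes refl = ⊥-elim (ℕₚ.<-irrefl refl i<j)
    ... | yes _ | no _ = refl
    ... | no _ | _ = refl
    split : ∀ i j → Pair i j → peeledCost R (v ∷ vs) c i j ≡ A i j + peeledCost (R ++ [ v ]) vs c′ i j
    split i j i<j rewrite mem-snoc i R v | mem-snoc j R v =
      first-peeled-split ⌊ i Fin.≟ v ⌋ ⌊ j Fin.≟ v ⌋ (mem i R) (mem j R) (mem i vs) (mem j vs) (w i j) c (firstHit vs i j)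
        (is-v-not-in-R i) (is-v-not-in-R j) (not-both-v i j i<j)
    G-sym : ∀ i j → G i j ≡ G j i
    G-sym i j rewrite w-sym i j | Boolₚ.∧-comm (not (mem i R)) (not (mem j R)) = refl
    G-at-v : ∀ u → (if ⌊ u Fin.≟ v ⌋ then 0ℚ else G v u) ≡ (if ⌊ u Fin.≟ v ⌋ ∨ mem u R then 0ℚ else w v u) * c 0
    G-at-v u with u Fin.≟ v
    ... | yes _ = sym (*-zeroˡ (c 0))
    ... | no _ rewrite v∉R with mem u R
    ... | true = sym (*-zeroˡ (c 0))
    ... | false = refl
    sumPairs-A : sumPairs A ≡ Wv w R v * c 0
    sumPairs-A = trans (sumPairs-incident G G-sym v) (trans (sumℚ-map-cong (allFin n) G-at-v) (sumℚ-map-*ʳ (c 0) _ (allFin n)))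

  redW≡sum-peelDegrees : ∀ {P} → PeelOff w γ [] P → redW w P ≡ sumℚ (peelDegrees [] P)
  redW≡sum-peelDegrees {P} po =
    trans (sumPairs-cong (λ i j _ → unit-cost i j)) (trans (sumPairs-peeledCost po (λ _ → 1ℚ)) (weightedSum-1 (peelDegrees [] P)))
    where
    unit-cost : ∀ i j → (if mem i P ∨ mem j P then w i j else 0ℚ) ≡ peeledCost [] P (λ _ → 1ℚ) i j
    unit-cost i j with mem i P ∨ mem j P
    ... | true = sym (*-identityʳ _)
    ... | false = refl

  peelDegrees-≥-threshold : ∀ {R P} → PeelOff w γ R P → All (threshold w γ ≤_) (peelDegrees R P)
  peelDegrees-≥-threshold (stop _) = []
  peelDegrees-≥-threshold (step v vs _ θ≤Wv _ po) = θ≤Wv ∷ peelDegrees-≥-threshold po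

  module _ (w-nonNeg : ∀ i j → 0ℚ ≤ w i j) where

    Wv-snoc-≤ : ∀ R v u → Wv w (R ++ [ v ]) u ≤ Wv w R u
    Wv-snoc-≤ R v u = sumℚ-map-mono (allFin n) (λ x _ → drop-edge x)
      where
      drop-edge : ∀ x → (if ⌊ x Fin.≟ u ⌋ ∨ mem x (R ++ [ v ]) then 0ℚ else w u x) ≤ (if ⌊ x Fin.≟ u ⌋ ∨ mem x R then 0ℚ else w u x)
      drop-edge x rewrite mem-snoc x R v with ⌊ x Fin.≟ u ⌋ | mem x R | ⌊ x Fin.≟ v ⌋
      ... | true | _ | _ = ≤-refl
      ... | false | true | _ = ≤-refl
      ... | false | false | true = w-nonNeg u x
      ... | false | false | false = ≤-refl

    -- degrees only drop as vertices are removed, and each peeled vertex had maximum degree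
    peelDegrees-descending : ∀ {R P} → PeelOff w γ R P → Linked _≥_ (peelDegrees R P)
    peelDegrees-descending (stop _) = []
    peelDegrees-descending (step v [] _ _ _ _) = [-]
    peelDegrees-descending {R} (step v (v′ ∷ vs) _ _ maximal po@(step _ _ v′∉R++v _ _ _)) =
      ≤-trans (Wv-snoc-≤ R v v′) (maximal v′ (∨≡false⇒ˡ (trans (sym (mem-snoc v′ R v)) v′∉R++v))) ∷ peelDegrees-descending po

-- The output tree

module Caterpillar (n : ℕ) where
  open Instance n
  open Membership n

  inM : Fin n → Maybe Tree → Bool
  inM x nothing = false
  inM x (just t) = inT x t

  sizeM : Maybe Tree → ℕ
  sizeM nothing = 0
  sizeM (just t) = size t

  inM-caterpillar : ∀ x P tB → inM x (caterpillar P tB) ≡ mem x P ∨ inM x tB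
  inM-caterpillar x [] tB = refl
  inM-caterpillar x (v ∷ vs) tB with caterpillar vs tB | inM-caterpillar x vs tB
  ... | nothing | ih = trans (sym (Boolₚ.∨-identityʳ _))
                        (trans (cong (⌊ x Fin.≟ v ⌋ ∨_) ih) (sym (Boolₚ.∨-assoc ⌊ x Fin.≟ v ⌋ (mem x vs) (inM x tB))))
  ... | just t | ih = trans (cong (⌊ x Fin.≟ v ⌋ ∨_) ih) (sym (Boolₚ.∨-assoc ⌊ x Fin.≟ v ⌋ (mem x vs) (inM x tB)))

  sizeM-caterpillar : ∀ P tB → sizeM (caterpillar P tB) ≡ length P ℕ.+ sizeM tB
  sizeM-caterpillar [] tB = refl
  sizeM-caterpillar (v ∷ vs) tB with caterpillar vs tB | sizeM-caterpillar vs tB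
  ... | nothing | ih = cong suc ih
  ... | just t | ih = cong suc ih

  leaf-≟ : ∀ {x v : Fin n} → ⌊ x Fin.≟ v ⌋ ≡ true → x ≡ v
  leaf-≟ {x} {v} p with x Fin.≟ v
  ... | yes x≡v = x≡v

  -- an edge touching P is separated at the spine node of its first peeled endpoint
  lcaSize-caterpillar-peeled : ∀ P tB → NoDup P → (∀ x → mem x P ≡ true → inM x tB ≡ false) → ∀ i j → i ≢ j →
    inM i (caterpillar P tB) ≡ true → inM j (caterpillar P tB) ≡ true → (mem i P ∨ mem j P) ≡ true →
    lcaSizeM (caterpillar P tB) i j ℕ.+ firstHit P i j ≡ length P ℕ.+ sizeM tB
  lcaSize-caterpillar-peeled [] tB _ _ i j _ _ _ ()
  lcaSize-caterpillar-peeled (v ∷ vs) tB (v∉vs , nd) disj i j i≢j i∈ j∈ hit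
      with caterpillar vs tB | inM-caterpillar i vs tB | inM-caterpillar j vs tB | sizeM-caterpillar vs tB
         | lcaSize-caterpillar-peeled vs tB nd (λ x x∈vs → disj x (trans (cong (⌊ x Fin.≟ v ⌋ ∨_) x∈vs) (Boolₚ.∨-zeroʳ _)))
  ... | nothing | _ | _ | _ | _ = ⊥-elim (i≢j (trans (leaf-≟ i∈) (sym (leaf-≟ j∈))))
  ... | just t | i∈t | j∈t | size-t | ih with i Fin.≟ v | j Fin.≟ v
  ... | yes refl | yes refl = ⊥-elim (i≢j refl)
  ... | yes refl | no _ rewrite trans i∈t (cong₂ _∨_ v∉vs (disj v (cong (_∨ mem v vs) (≟-refl v)))) | sym size-t = ℕₚ.+-identityʳ _
  ... | no _ | yes refl rewrite trans j∈t (cong₂ _∨_ v∉vs (disj v (cong (_∨ mem v vs) (≟-refl v)))) | sym size-t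
                              | Boolₚ.∧-zeroʳ (inT i t) = ℕₚ.+-identityʳ _
  ... | no _ | no _ rewrite i∈ | j∈ = trans (ℕₚ.+-suc _ _) (cong suc (ih i j i≢j i∈ j∈ hit))

  lcaSize-caterpillar-remaining : ∀ P t i j → mem i P ≡ false → mem j P ≡ false → inT i t ≡ true → inT j t ≡ true →
    lcaSizeM (caterpillar P (just t)) i j ≡ lcaSize t i j
  lcaSize-caterpillar-remaining [] t i j _ _ _ _ = refl
  lcaSize-caterpillar-remaining (v ∷ vs) t i j i∉P j∉P i∈t j∈t
      with caterpillar vs (just t) | inM-caterpillar i vs (just t) | inM-caterpillar j vs (just t)
         | lcaSize-caterpillar-remaining vs t i j (∨≡false⇒ʳ i∉P) (∨≡false⇒ʳ j∉P) i∈t j∈t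
  ... | nothing | i∈c | _ | _ with trans i∈c (trans (cong (mem i vs ∨_) i∈t) (Boolₚ.∨-zeroʳ _))
  ...   | ()
  lcaSize-caterpillar-remaining (v ∷ vs) t i j i∉P j∉P i∈t j∈t | just t′ | i∈c | j∈c | ih with i Fin.≟ v
  ... | yes refl with i∉P
  ...   | ()
  lcaSize-caterpillar-remaining (v ∷ vs) t i j i∉P j∉P i∈t j∈t | just t′ | i∈c | j∈c | ih | no _
    rewrite trans i∈c (trans (cong (mem i vs ∨_) i∈t) (Boolₚ.∨-zeroʳ _))
          | trans j∈c (trans (cong (mem j vs ∨_) j∈t) (Boolₚ.∨-zeroʳ _)) = ih

All-concatMap⁺ : ∀ {A B : Set} {P : B → Set} (f : A → List B) {L : List A} → All (λ x → All P (f x)) L → All P (concatMap f L)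
All-concatMap⁺ f = Allₚ.concat⁺ ∘ Allₚ.map⁺

module RandomPartitioning (n : ℕ) where
  open Instance n
  open Membership n
  open Splits n

  pS : List (Fin n) → ℚ
  pS S = 1ℚ ÷' ℕ→ℚ (length (valid S))

  𝔼 : (Tree → ℚ) → List (ℚ × Tree) → ℚ
  𝔼 h D = sumℚ (map (λ qt → proj₁ qt * h (proj₂ qt)) D)

  LeafSet : List (Fin n) → ℚ × Tree → Set
  LeafSet S qt = (∀ x → inT x (proj₂ qt) ≡ mem x S) × (size (proj₂ qt) ≡ length S)

  node-LeafSet : ∀ S a → length a ≡ length S → ∀ {z₁ z₂ : ℚ × Tree} → LeafSet (T-side S a) z₁ → LeafSet (F-side S a) z₂ →
    ∀ q → LeafSet S (q , node (proj₂ z₁) (proj₂ z₂))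
  node-LeafSet S a a-len (in₁ , size₁) (in₂ , size₂) q =
    (λ x → trans (cong₂ _∨_ (in₁ x) (in₂ x)) (sym (mem-sides x S a a-len))) ,
    trans (cong₂ ℕ._+_ size₁ size₂) (length-sides S a a-len)

  RP-LeafSet : ∀ k S → All (LeafSet S) (RP k S)
  RP-LeafSet k [] = All.[]
  RP-LeafSet k (v ∷ []) = ((λ x → sym (Boolₚ.∨-identityʳ _)) , refl) All.∷ All.[]
  RP-LeafSet zero (x ∷ y ∷ zs) = All.[]
  RP-LeafSet (suc k) S@(x ∷ y ∷ zs) =
    All-concatMap⁺ _ (All.tabulate λ {a} a∈ →
      All-concatMap⁺ _ (All.map (λ {z₁} sh₁ →
        Allₚ.map⁺ (All.map (λ {z₂} sh₂ → node-LeafSet S a (proj₁ (valid⇒sizes S a a∈)) {z₁} {z₂} sh₁ sh₂ (pS S * proj₁ z₁ * proj₁ z₂))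
                           (RP-LeafSet k (F-side S a))))
        (RP-LeafSet k (T-side S a))))

  𝔼-RP-suc : ∀ k x y zs (h : Tree → ℚ) → let S = x ∷ y ∷ zs in
    𝔼 h (RP (suc k) S) ≡ sumℚ (map (λ a → sumℚ (map (λ z₁ → sumℚ (map (λ z₂ → (pS S * proj₁ z₁ * proj₁ z₂) * h (node (proj₂ z₁) (proj₂ z₂)))
                                 (RP k (F-side S a)))) (RP k (T-side S a)))) (valid S))
  𝔼-RP-suc k x y zs h = trans (sumℚ-map-concatMap _ _ (valid S))
    (sumℚ-map-cong (valid S) (λ a → trans (sumℚ-map-concatMap _ _ (RP k (T-side S a)))
      (sumℚ-map-cong (RP k (T-side S a)) (λ z₁ → sumℚ-map-map _ _ (RP k (F-side S a))))))
    where S = x ∷ y ∷ zs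

  length-valid*pS : ∀ x y zs → ℕ→ℚ (length (valid (x ∷ y ∷ zs))) * pS (x ∷ y ∷ zs) ≡ 1ℚ
  length-valid*pS x y zs = cancel (length (valid (x ∷ y ∷ zs))) (1≤length-valid x y zs)
    where
    cancel : ∀ m → 1 ℕ.≤ m → ℕ→ℚ m * (1ℚ ÷' ℕ→ℚ m) ≡ 1ℚ
    cancel (suc m) _ = *-÷'-cancel 1ℚ (ℕ→ℚ (suc m)) (0<⇒≢0 (0<ℕ→ℚ-suc m))

  0≤pS : ∀ x y zs → 0ℚ ≤ pS (x ∷ y ∷ zs)
  0≤pS x y zs = inverse-nonNeg (length (valid (x ∷ y ∷ zs))) (pS (x ∷ y ∷ zs)) (1≤length-valid x y zs) (length-valid*pS x y zs)
    where
    inverse-nonNeg : ∀ m p → 1 ℕ.≤ m → ℕ→ℚ m * p ≡ 1ℚ → 0ℚ ≤ p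
    inverse-nonNeg (suc m) p _ e = *-cancelˡ-≤-0< (0<ℕ→ℚ-suc m)
      (≤-trans (≤-reflexive (*-zeroʳ (ℕ→ℚ (suc m)))) (≤-trans 0≤1 (≤-reflexive (sym e))))

  𝔼-product : ∀ (c : ℚ) (D₁ D₂ : List (ℚ × Tree)) (f₁ f₂ : Tree → ℚ) →
    sumℚ (map (λ z₁ → sumℚ (map (λ z₂ → (c * proj₁ z₁ * proj₁ z₂) * (f₁ (proj₂ z₁) * f₂ (proj₂ z₂))) D₂)) D₁) ≡ c * 𝔼 f₁ D₁ * 𝔼 f₂ D₂
  𝔼-product c D₁ D₂ f₁ f₂ = begin
      sumℚ (map (λ z₁ → sumℚ (map (λ z₂ → (c * proj₁ z₁ * proj₁ z₂) * (f₁ (proj₂ z₁) * f₂ (proj₂ z₂))) D₂)) D₁)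
    ≡⟨ sumℚ-map-cong D₁ (λ z₁ → trans (sumℚ-map-cong D₂ (λ z₂ → regroup (proj₁ z₁) (proj₁ z₂) (f₁ (proj₂ z₁)) (f₂ (proj₂ z₂))))
                                       (sumℚ-map-*ˡ (c * (proj₁ z₁ * f₁ (proj₂ z₁))) (λ z₂ → proj₁ z₂ * f₂ (proj₂ z₂)) D₂)) ⟩
      sumℚ (map (λ z₁ → (c * (proj₁ z₁ * f₁ (proj₂ z₁))) * 𝔼 f₂ D₂) D₁)
    ≡⟨ sumℚ-map-*ʳ (𝔼 f₂ D₂) (λ z₁ → c * (proj₁ z₁ * f₁ (proj₂ z₁))) D₁ ⟩
      sumℚ (map (λ z₁ → c * (proj₁ z₁ * f₁ (proj₂ z₁))) D₁) * 𝔼 f₂ D₂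
    ≡⟨ cong (_* 𝔼 f₂ D₂) (sumℚ-map-*ˡ c (λ z₁ → proj₁ z₁ * f₁ (proj₂ z₁)) D₁) ⟩
      c * 𝔼 f₁ D₁ * 𝔼 f₂ D₂
    ∎
    where
    open ≡-Reasoning
    regroup : ∀ q₁ q₂ a b → (c * q₁ * q₂) * (a * b) ≡ (c * (q₁ * a)) * (q₂ * b)
    regroup = solve 5 (λ c q₁ q₂ a b → (c :* q₁ :* q₂) :* (a :* b) := (c :* (q₁ :* a)) :* (q₂ :* b)) refl c

  𝔼-RP-1 : ∀ k S → length S ℕ.≤ k → 1 ℕ.≤ length S → 𝔼 (λ _ → 1ℚ) (RP k S) ≡ 1ℚ
  𝔼-RP-1 k (v ∷ []) _ _ = refl
  𝔼-RP-1 (suc k) (x ∷ y ∷ zs) S≤1+k _ = begin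
      𝔼 (λ _ → 1ℚ) (RP (suc k) S)
    ≡⟨ 𝔼-RP-suc k x y zs (λ _ → 1ℚ) ⟩
      sumℚ (map (λ a → sumℚ (map (λ z₁ → sumℚ (map (λ z₂ → (pS S * proj₁ z₁ * proj₁ z₂) * 1ℚ) (RP k (F-side S a)))) (RP k (T-side S a)))) (valid S))
    ≡⟨ sumℚ-map-cong-∈ (valid S) per-split ⟩
      sumℚ (map (λ _ → pS S) (valid S))
    ≡⟨ sumℚ-map-const (pS S) (valid S) ⟩
      ℕ→ℚ (length (valid S)) * pS S
    ≡⟨ length-valid*pS x y zs ⟩
      1ℚ
    ∎
    where
    open ≡-Reasoning
    S = x ∷ y ∷ zs
    per-split : ∀ a → a ∈ valid S →
      sumℚ (map (λ z₁ → sumℚ (map (λ z₂ → (pS S * proj₁ z₁ * proj₁ z₂) * 1ℚ) (RP k (F-side S a)))) (RP k (T-side S a))) ≡ pS S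
    per-split a a∈ = trans (𝔼-product (pS S) (RP k (T-side S a)) (RP k (F-side S a)) (λ _ → 1ℚ) (λ _ → 1ℚ))
      (trans (cong₂ (λ u v → pS S * u * v) (𝔼-RP-1 k (T-side S a) (proj₁ sides≤k) (proj₁ (proj₂ sizes)))
                                           (𝔼-RP-1 k (F-side S a) (proj₂ sides≤k) (proj₂ (proj₂ sizes))))
             (trans (*-identityʳ _) (*-identityʳ _)))
      where
      sides≤k = length-sides-≤ S a k a∈ S≤1+k
      sizes = valid⇒sizes S a a∈

ℕ→ℚ-sum : ∀ {A : Set} (f : A → ℕ) (L : List A) → ℕ→ℚ (sum (map f L)) ≡ sumℚ (map (λ a → ℕ→ℚ (f a)) L)
ℕ→ℚ-sum f [] = refl
ℕ→ℚ-sum f (x ∷ L) = trans (ℕ→ℚ-+ (f x) _) (cong (ℕ→ℚ (f x) +_) (ℕ→ℚ-sum f L))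

module ExpectedLca (n : ℕ) where
  open Instance n
  open Membership n
  open Splits n
  open RandomPartitioning n
  open SplitCounting n

  lcaℚ : Fin n → Fin n → Tree → ℚ
  lcaℚ i j t = ℕ→ℚ (lcaSize t i j)

  𝔼-const : ∀ (v : ℚ) D → 𝔼 (λ _ → v) D ≡ 𝔼 (λ _ → 1ℚ) D * v
  𝔼-const v D = trans (sumℚ-map-cong D (λ z → cong (_* v) (sym (*-identityʳ (proj₁ z))))) (sumℚ-map-*ʳ v (λ z → proj₁ z * 1ℚ) D)

  -- given the split: if i, j stay on one side, the lca lies in that side's subtree; otherwise it is the new node
  𝔼-lca-node-≥ : ∀ i j (bT bF : Bool) (D₁ D₂ : List (ℚ × Tree)) (A B N : ℕ) (c : ℚ) →
    𝔼 (λ _ → 1ℚ) D₁ ≡ 1ℚ → 𝔼 (λ _ → 1ℚ) D₂ ≡ 1ℚ →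
    (bT ≡ true → ℕ→ℚ A ≤ ℕ→ℚ 3 * 𝔼 (lcaℚ i j) D₁) → (bF ≡ true → ℕ→ℚ B ≤ ℕ→ℚ 3 * 𝔼 (lcaℚ i j) D₂) → 0ℚ ≤ c →
    c * ℕ→ℚ (if bT then A else (if bF then B else 3 ℕ.* N)) ≤
    ℕ→ℚ 3 * sumℚ (map (λ z₁ → sumℚ (map (λ z₂ → (c * proj₁ z₁ * proj₁ z₂)
                      * ℕ→ℚ (if bT then lcaSize (proj₂ z₁) i j else (if bF then lcaSize (proj₂ z₂) i j else N))) D₂)) D₁)
  𝔼-lca-node-≥ i j true bF D₁ D₂ A B N c _ 𝔼D₂≡1 A≤ _ 0≤c = begin
      c * ℕ→ℚ A
    ≤⟨ *-monoˡ-≤-0≤ 0≤c (A≤ refl) ⟩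
      c * (ℕ→ℚ 3 * 𝔼 (lcaℚ i j) D₁)
    ≡⟨ solve 3 (λ c t e → c :* (t :* e) := t :* (c :* e :* con 1ℚ)) refl c (ℕ→ℚ 3) (𝔼 (lcaℚ i j) D₁) ⟩
      ℕ→ℚ 3 * (c * 𝔼 (lcaℚ i j) D₁ * 1ℚ)
    ≡⟨ cong (λ u → ℕ→ℚ 3 * (c * 𝔼 (lcaℚ i j) D₁ * u)) (sym 𝔼D₂≡1) ⟩
      ℕ→ℚ 3 * (c * 𝔼 (lcaℚ i j) D₁ * 𝔼 (λ _ → 1ℚ) D₂)
    ≡⟨ cong (ℕ→ℚ 3 *_) (sym (trans (sumℚ-map-cong D₁ (λ z₁ → sumℚ-map-cong D₂ (λ z₂ → cong ((c * proj₁ z₁ * proj₁ z₂) *_) (sym (*-identityʳ _)))))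
                                   (𝔼-product c D₁ D₂ (lcaℚ i j) (λ _ → 1ℚ)))) ⟩
      ℕ→ℚ 3 * sumℚ (map (λ z₁ → sumℚ (map (λ z₂ → (c * proj₁ z₁ * proj₁ z₂) * ℕ→ℚ (lcaSize (proj₂ z₁) i j)) D₂)) D₁)
    ∎
    where open ≤-Reasoning
  𝔼-lca-node-≥ i j false true D₁ D₂ A B N c 𝔼D₁≡1 _ _ B≤ 0≤c = begin
      c * ℕ→ℚ B
    ≤⟨ *-monoˡ-≤-0≤ 0≤c (B≤ refl) ⟩
      c * (ℕ→ℚ 3 * 𝔼 (lcaℚ i j) D₂)
    ≡⟨ solve 3 (λ c t e → c :* (t :* e) := t :* (c :* con 1ℚ :* e)) refl c (ℕ→ℚ 3) (𝔼 (lcaℚ i j) D₂) ⟩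
      ℕ→ℚ 3 * (c * 1ℚ * 𝔼 (lcaℚ i j) D₂)
    ≡⟨ cong (λ u → ℕ→ℚ 3 * (c * u * 𝔼 (lcaℚ i j) D₂)) (sym 𝔼D₁≡1) ⟩
      ℕ→ℚ 3 * (c * 𝔼 (λ _ → 1ℚ) D₁ * 𝔼 (lcaℚ i j) D₂)
    ≡⟨ cong (ℕ→ℚ 3 *_) (sym (trans (sumℚ-map-cong D₁ (λ z₁ → sumℚ-map-cong D₂ (λ z₂ → cong ((c * proj₁ z₁ * proj₁ z₂) *_) (sym (*-identityˡ _)))))
                                   (𝔼-product c D₁ D₂ (λ _ → 1ℚ) (lcaℚ i j)))) ⟩
      ℕ→ℚ 3 * sumℚ (map (λ z₁ → sumℚ (map (λ z₂ → (c * proj₁ z₁ * proj₁ z₂) * ℕ→ℚ (lcaSize (proj₂ z₂) i j)) D₂)) D₁)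
    ∎
    where open ≤-Reasoning
  𝔼-lca-node-≥ i j false false D₁ D₂ A B N c 𝔼D₁≡1 𝔼D₂≡1 _ _ _ = ≤-reflexive (begin
      c * ℕ→ℚ (3 ℕ.* N)
    ≡⟨ cong (c *_) (ℕ→ℚ-* 3 N) ⟩
      c * (ℕ→ℚ 3 * ℕ→ℚ N)
    ≡⟨ solve 3 (λ c t v → c :* (t :* v) := t :* (c :* (con 1ℚ :* v) :* con 1ℚ)) refl c (ℕ→ℚ 3) (ℕ→ℚ N) ⟩
      ℕ→ℚ 3 * (c * (1ℚ * ℕ→ℚ N) * 1ℚ)
    ≡⟨ cong₂ (λ u v → ℕ→ℚ 3 * (c * (u * ℕ→ℚ N) * v)) (sym 𝔼D₁≡1) (sym 𝔼D₂≡1) ⟩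
      ℕ→ℚ 3 * (c * (𝔼 (λ _ → 1ℚ) D₁ * ℕ→ℚ N) * 𝔼 (λ _ → 1ℚ) D₂)
    ≡⟨ cong (λ u → ℕ→ℚ 3 * (c * u * 𝔼 (λ _ → 1ℚ) D₂)) (sym (𝔼-const (ℕ→ℚ N) D₁)) ⟩
      ℕ→ℚ 3 * (c * 𝔼 (λ _ → ℕ→ℚ N) D₁ * 𝔼 (λ _ → 1ℚ) D₂)
    ≡⟨ cong (ℕ→ℚ 3 *_) (sym (trans (sumℚ-map-cong D₁ (λ z₁ → sumℚ-map-cong D₂ (λ z₂ → cong ((c * proj₁ z₁ * proj₁ z₂) *_) (sym (*-identityʳ _)))))
                                   (𝔼-product c D₁ D₂ (λ _ → ℕ→ℚ N) (λ _ → 1ℚ)))) ⟩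
      ℕ→ℚ 3 * sumℚ (map (λ z₁ → sumℚ (map (λ z₂ → (c * proj₁ z₁ * proj₁ z₂) * ℕ→ℚ N) D₂)) D₁)
    ∎)
    where open ≡-Reasoning

  mem-singleton : ∀ (x v : Fin n) → mem x (v ∷ []) ≡ true → x ≡ v
  mem-singleton x v h with x Fin.≟ v
  ... | yes x≡v = x≡v
  mem-singleton x v () | no _

  𝔼-lca-RP-≥ : ∀ k S i j → NoDup S → length S ℕ.≤ k → i ≢ j → mem i S ≡ true → mem j S ≡ true →
    ℕ→ℚ (2 ℕ.* length S) ≤ ℕ→ℚ 3 * 𝔼 (lcaℚ i j) (RP k S)
  𝔼-lca-RP-≥ k (v ∷ []) i j _ _ i≢j i∈S j∈S = ⊥-elim (i≢j (trans (mem-singleton i v i∈S) (sym (mem-singleton j v j∈S))))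
  𝔼-lca-RP-≥ (suc k) (x ∷ y ∷ zs) i j nd S≤1+k i≢j i∈S j∈S = begin
      ℕ→ℚ (2 ℕ.* length S)
    ≡⟨ sym (trans (cong (ℕ→ℚ (2 ℕ.* length S) *_) (length-valid*pS x y zs)) (*-identityʳ _)) ⟩
      ℕ→ℚ (2 ℕ.* length S) * (ℕ→ℚ (length (valid S)) * pS S)
    ≡⟨ trans (solve 3 (λ a b p → a :* (b :* p) := p :* (a :* b)) refl (ℕ→ℚ (2 ℕ.* length S)) (ℕ→ℚ (length (valid S))) (pS S))
             (cong (pS S *_) (sym (ℕ→ℚ-* (2 ℕ.* length S) (length (valid S))))) ⟩
      pS S * ℕ→ℚ (2 ℕ.* length S ℕ.* length (valid S))
    ≤⟨ *-monoˡ-≤-0≤ (0≤pS x y zs) (ℕ→ℚ-mono-≤ (sum-valid-sideCost S i j nd i≢j i∈S j∈S)) ⟩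
      pS S * ℕ→ℚ (sum (map (sideCost S i j) (valid S)))
    ≡⟨ trans (cong (pS S *_) (ℕ→ℚ-sum (sideCost S i j) (valid S))) (sym (sumℚ-map-*ˡ (pS S) (λ a → ℕ→ℚ (sideCost S i j a)) (valid S))) ⟩
      sumℚ (map (λ a → pS S * ℕ→ℚ (sideCost S i j a)) (valid S))
    ≤⟨ sumℚ-map-mono (valid S) per-split ⟩
      sumℚ (map (λ a → ℕ→ℚ 3 * C a) (valid S))
    ≡⟨ sumℚ-map-*ˡ (ℕ→ℚ 3) C (valid S) ⟩
      ℕ→ℚ 3 * sumℚ (map C (valid S))
    ≡⟨ cong (ℕ→ℚ 3 *_) (sym (𝔼-RP-suc k x y zs (lcaℚ i j))) ⟩
      ℕ→ℚ 3 * 𝔼 (lcaℚ i j) (RP (suc k) S)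
    ∎
    where
    open ≤-Reasoning
    S = x ∷ y ∷ zs
    C : List Bool → ℚ
    C a = sumℚ (map (λ z₁ → sumℚ (map (λ z₂ → (pS S * proj₁ z₁ * proj₁ z₂) * lcaℚ i j (node (proj₂ z₁) (proj₂ z₂)))
                   (RP k (F-side S a)))) (RP k (T-side S a)))
    per-split : ∀ a → a ∈ valid S → pS S * ℕ→ℚ (sideCost S i j a) ≤ ℕ→ℚ 3 * C a
    per-split a a∈ = ≤-trans
        (𝔼-lca-node-≥ i j bT bF D₁ D₂ (2 ℕ.* length T) (2 ℕ.* length F) (length S) (pS S)
           (𝔼-RP-1 k T (proj₁ sides≤k) (proj₁ (proj₂ sizes))) (𝔼-RP-1 k F (proj₂ sides≤k) (proj₂ (proj₂ sizes)))
           (λ e → 𝔼-lca-RP-≥ k T i j (NoDup-sideOf true S a nd) (proj₁ sides≤k) i≢j (∧≡true⇒ˡ e) (∧≡true⇒ʳ e))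
           (λ e → 𝔼-lca-RP-≥ k F i j (NoDup-sideOf false S a nd) (proj₂ sides≤k) i≢j (∧≡true⇒ˡ e) (∧≡true⇒ʳ e))
           (0≤pS x y zs))
        (≤-reflexive (cong (ℕ→ℚ 3 *_) (sumℚ-map-cong-∈ D₁ (λ z₁ z₁∈ → sumℚ-map-cong-∈ D₂ (λ z₂ z₂∈ →
           cong ((pS S * proj₁ z₁ * proj₁ z₂) *_) (cong ℕ→ℚ (sym (lca-node z₁ z₂ z₁∈ z₂∈))))))))
      where
      T = T-side S a
      F = F-side S a
      D₁ = RP k T
      D₂ = RP k F
      bT = mem i T ∧ mem j T
      bF = mem i F ∧ mem j F
      sides≤k = length-sides-≤ S a k a∈ S≤1+k
      sizes = valid⇒sizes S a a∈
      lca-node : ∀ z₁ z₂ → z₁ ∈ D₁ → z₂ ∈ D₂ →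
        lcaSize (node (proj₂ z₁) (proj₂ z₂)) i j ≡ (if bT then lcaSize (proj₂ z₁) i j else (if bF then lcaSize (proj₂ z₂) i j else length S))
      lca-node z₁ z₂ z₁∈ z₂∈
        rewrite proj₁ (All.lookup (RP-LeafSet k T) z₁∈) i | proj₁ (All.lookup (RP-LeafSet k T) z₁∈) j
              | proj₁ (All.lookup (RP-LeafSet k F) z₂∈) i | proj₁ (All.lookup (RP-LeafSet k F) z₂∈) j
              | proj₂ (All.lookup (RP-LeafSet k T) z₁∈) | proj₂ (All.lookup (RP-LeafSet k F) z₂∈) | length-sides S a (proj₁ sizes) = refl

module Remaining (n : ℕ) where
  open Instance n
  open Membership n

  Unique⇒NoDup : ∀ {xs} → Unique xs → NoDup xs
  Unique⇒NoDup [] = tt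
  Unique⇒NoDup (x∉xs ∷ u) = ≢-all⇒mem≡false x∉xs , Unique⇒NoDup u
    where
    ≢-all⇒mem≡false : ∀ {x xs} → All (x ≢_) xs → mem x xs ≡ false
    ≢-all⇒mem≡false [] = refl
    ≢-all⇒mem≡false {x} {u ∷ xs} (x≢u ∷ rest) with x Fin.≟ u
    ... | yes x≡u = ⊥-elim (x≢u x≡u)
    ... | no _ = ≢-all⇒mem≡false rest

  reject : (Fin n → Bool) → List (Fin n) → List (Fin n)
  reject f = filter (λ v → Bool._≟_ (f v) false)

  mem-reject : ∀ x f L → mem x (reject f L) ≡ mem x L ∧ not (f x)
  mem-reject x f [] = refl
  mem-reject x f (u ∷ L) with f u in fu
  ... | true with x Fin.≟ u
  ...   | yes refl = trans (mem-reject u f L) (trans (cong (λ b → mem u L ∧ not b) fu) (trans (Boolₚ.∧-zeroʳ _) (cong not (sym fu))))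
  ...   | no _ = mem-reject x f L
  mem-reject x f (u ∷ L) | false with x Fin.≟ u
  ...   | yes refl rewrite fu = refl
  ...   | no _ = mem-reject x f L

  mem-remaining : ∀ x P → mem x (remaining P) ≡ not (mem x P)
  mem-remaining x P = trans (mem-reject x (λ v → mem v P) (allFin n)) (cong (_∧ not (mem x P)) (mem-allFin x))

  NoDup-remaining : ∀ P → NoDup (remaining P)
  NoDup-remaining P = Unique⇒NoDup (filter⁺ _ (allFin⁺ n))

  reject-none : ∀ f L → (∀ x → mem x L ≡ true → f x ≡ false) → reject f L ≡ L
  reject-none f [] _ = refl
  reject-none f (u ∷ L) h with f u in fu
  ... | true with trans (sym fu) (h u (cong (_∨ mem u L) (≟-refl u)))
  ...   | ()
  reject-none f (u ∷ L) h | false = cong (u ∷_) (reject-none f L (λ x x∈L → h x (trans (cong (⌊ x Fin.≟ u ⌋ ∨_) x∈L) (Boolₚ.∨-zeroʳ _))))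

  reject-∨ : ∀ g h L → reject (λ u → g u ∨ h u) L ≡ reject g (reject h L)
  reject-∨ g h [] = refl
  reject-∨ g h (u ∷ L) with g u in gu | h u in hu
  ... | true | true = reject-∨ g h L
  ... | true | false rewrite gu = reject-∨ g h L
  ... | false | true = reject-∨ g h L
  ... | false | false rewrite gu = cong (u ∷_) (reject-∨ g h L)

  length-reject-≟ : ∀ v K → NoDup K → mem v K ≡ true → suc (length (reject (λ u → ⌊ u Fin.≟ v ⌋) K)) ≡ length K
  length-reject-≟ v (u ∷ K) (u∉K , nd) v∈ with u Fin.≟ v
  ... | yes refl = cong (λ l → suc (length l)) (reject-none (λ x → ⌊ x Fin.≟ u ⌋) K not-u)
    where
    not-u : ∀ x → mem x K ≡ true → ⌊ x Fin.≟ u ⌋ ≡ false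
    not-u x x∈K with x Fin.≟ u
    ... | yes refl with trans (sym u∉K) x∈K
    ...   | ()
    not-u x x∈K | no _ = refl
  ... | no u≢v = cong suc (length-reject-≟ v K nd (trans (sym (cong (_∨ mem v K) (v≢u (λ e → u≢v (sym e))))) v∈))
    where
    v≢u : v ≢ u → ⌊ v Fin.≟ u ⌋ ≡ false
    v≢u v≢u with v Fin.≟ u
    ... | yes v≡u = ⊥-elim (v≢u v≡u)
    ... | no _ = refl

  length-remaining : ∀ P → NoDup P → length (remaining P) ℕ.+ length P ≡ n
  length-remaining [] _ = trans (ℕₚ.+-identityʳ _) (trans (cong length (reject-none (λ _ → false) (allFin n) (λ _ _ → refl))) (Listₚ.length-tabulate (λ x → x)))
  length-remaining (v ∷ P) (v∉P , nd) = begin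
      length (reject (λ x → ⌊ x Fin.≟ v ⌋ ∨ mem x P) (allFin n)) ℕ.+ suc (length P)
    ≡⟨ cong (λ l → length l ℕ.+ suc (length P)) (reject-∨ (λ x → ⌊ x Fin.≟ v ⌋) (λ x → mem x P) (allFin n)) ⟩
      length (reject (λ x → ⌊ x Fin.≟ v ⌋) (remaining P)) ℕ.+ suc (length P)
    ≡⟨ ℕₚ.+-suc _ _ ⟩
      suc (length (reject (λ x → ⌊ x Fin.≟ v ⌋) (remaining P))) ℕ.+ length P
    ≡⟨ cong (ℕ._+ length P) (length-reject-≟ v (remaining P) (NoDup-remaining P) (trans (mem-remaining v P) (cong not v∉P))) ⟩
      length (remaining P) ℕ.+ length P
    ≡⟨ length-remaining P nd ⟩
      n
    ∎
    where open ≡-Reasoning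

module OutputTree (n : ℕ) where
  open Instance n
  open Membership n
  open Caterpillar n
  open RandomPartitioning n
  open ExpectedLca n
  open Remaining n

  𝔼lca : List (Fin n) → Fin n → Fin n → ℚ
  𝔼lca peel i j = sumℚ (map (λ x → proj₁ x * ℕ→ℚ (lcaSizeM (proj₂ x) i j)) (outputDist peel))

  𝔼lca-peeled : ∀ peel → NoDup peel → ∀ i j → i ≢ j → (mem i peel ∨ mem j peel) ≡ true →
    𝔼lca peel i j ≡ ℕ→ℚ (n ℕ.∸ firstHit peel i j)
  𝔼lca-peeled peel nd i j i≢j hit with remaining peel in VB≡ | mem-remaining i peel | mem-remaining j peel | length-remaining peel nd
  ... | [] | i∈VB | j∈VB | sizes = trans (+-identityʳ _) (trans (*-identityˡ _) (cong ℕ→ℚ (sym (lca≡n∸firstHit lca+hit))))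
    where
    lca≡n∸firstHit : lcaSizeM (caterpillar peel nothing) i j ℕ.+ firstHit peel i j ≡ length peel →
                     n ℕ.∸ firstHit peel i j ≡ lcaSizeM (caterpillar peel nothing) i j
    lca≡n∸firstHit e = trans (cong (ℕ._∸ firstHit peel i j) (trans (sym sizes) (sym e))) (ℕₚ.m+n∸n≡m _ (firstHit peel i j))
    in-caterpillar : ∀ x → mem x (remaining peel) ≡ not (mem x peel) → (remaining peel) ≡ [] → inM x (caterpillar peel nothing) ≡ true
    in-caterpillar x x∈VB VB≡[] = trans (inM-caterpillar x peel nothing) (trans (Boolₚ.∨-identityʳ _) (not-false (sym (trans (cong (mem x) (sym VB≡[])) x∈VB))))
      where
      not-false : ∀ {b} → not b ≡ false → b ≡ true
      not-false {true} _ = refl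
    lca+hit = trans (lcaSize-caterpillar-peeled peel nothing nd (λ _ _ → refl) i j i≢j
                       (in-caterpillar i (mem-remaining i peel) VB≡) (in-caterpillar j (mem-remaining j peel) VB≡) hit)
                    (ℕₚ.+-identityʳ _)
  ... | v ∷ vs | _ | _ | sizes = trans (sumℚ-map-map _ _ (RP (length VB) VB))
      (trans (sumℚ-map-cong-∈ (RP (length VB) VB) (λ z z∈ → cong (proj₁ z *_) (cong ℕ→ℚ (lca-constant z z∈))))
        (trans (𝔼-const (ℕ→ℚ (n ℕ.∸ firstHit peel i j)) (RP (length VB) VB))
          (trans (cong (_* ℕ→ℚ (n ℕ.∸ firstHit peel i j)) (𝔼-RP-1 (length VB) VB ℕₚ.≤-refl (ℕ.s≤s ℕ.z≤n))) (*-identityˡ _))))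
    where
    VB = v ∷ vs
    mem-VB : ∀ x → mem x VB ≡ not (mem x peel)
    mem-VB x = trans (cong (mem x) (sym VB≡)) (mem-remaining x peel)
    lca-constant : ∀ z → z ∈ RP (length VB) VB → lcaSizeM (caterpillar peel (just (proj₂ z))) i j ≡ n ℕ.∸ firstHit peel i j
    lca-constant z z∈ = sym (trans (cong (ℕ._∸ firstHit peel i j) (trans (sym sizes) (trans (ℕₚ.+-comm (length VB) (length peel)) (sym lca+hit))))
                                   (ℕₚ.m+n∸n≡m (lcaSizeM (caterpillar peel (just (proj₂ z))) i j) (firstHit peel i j)))
      where
      shape = All.lookup (RP-LeafSet (length VB) VB) z∈
      in-caterpillar : ∀ x → inM x (caterpillar peel (just (proj₂ z))) ≡ true
      in-caterpillar x = trans (inM-caterpillar x peel (just (proj₂ z))) (trans (cong (mem x peel ∨_) (trans (proj₁ shape x) (mem-VB x))) (excluded-middle (mem x peel)))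
        where
        excluded-middle : ∀ b → b ∨ not b ≡ true
        excluded-middle true = refl
        excluded-middle false = refl
      lca+hit = trans (lcaSize-caterpillar-peeled peel (just (proj₂ z)) nd (λ x x∈P → trans (proj₁ shape x) (trans (mem-VB x) (cong not x∈P)))
                         i j i≢j (in-caterpillar i) (in-caterpillar j) hit)
                      (cong (length peel ℕ.+_) (proj₂ shape))

  𝔼lca-remaining-≥ : ∀ peel → ∀ i j → i ≢ j → mem i peel ≡ false → mem j peel ≡ false →
    ℕ→ℚ (2 ℕ.* length (remaining peel)) ≤ ℕ→ℚ 3 * 𝔼lca peel i j
  𝔼lca-remaining-≥ peel i j i≢j i∉P j∉P with remaining peel in VB≡ | mem-remaining i peel
  ... | [] | i∈VB with trans i∈VB (cong not i∉P)
  ...   | ()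
  𝔼lca-remaining-≥ peel i j i≢j i∉P j∉P | v ∷ vs | _ =
    ≤-trans (𝔼-lca-RP-≥ (length VB) VB i j (subst NoDup VB≡ (NoDup-remaining peel)) ℕₚ.≤-refl i≢j (∈VB i i∉P) (∈VB j j∉P))
      (≤-reflexive (cong (ℕ→ℚ 3 *_) (sym (trans (sumℚ-map-map _ _ (RP (length VB) VB))
         (sumℚ-map-cong-∈ (RP (length VB) VB) (λ z z∈ → cong (λ l → proj₁ z * ℕ→ℚ l) (lca-inside z z∈)))))))
    where
    VB = v ∷ vs
    ∈VB : ∀ x → mem x peel ≡ false → mem x VB ≡ true
    ∈VB x x∉P = trans (cong (mem x) (sym VB≡)) (trans (mem-remaining x peel) (cong not x∉P))
    lca-inside : ∀ z → z ∈ RP (length VB) VB → lcaSizeM (caterpillar peel (just (proj₂ z))) i j ≡ lcaSize (proj₂ z) i j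
    lca-inside z z∈ = lcaSize-caterpillar-remaining peel (proj₂ z) i j i∉P j∉P
      (trans (proj₁ (All.lookup (RP-LeafSet (length VB) VB) z∈) i) (∈VB i i∉P))
      (trans (proj₁ (All.lookup (RP-LeafSet (length VB) VB) z∈) j) (∈VB j j∉P))

-- The final estimate

length*≤sum : ∀ θ as → All (θ ≤_) as → ℕ→ℚ (length as) * θ ≤ sumℚ as
length*≤sum θ [] [] = ≤-reflexive (*-zeroˡ θ)
length*≤sum θ (a ∷ as) (θ≤a ∷ θ≤as) = ≤-trans
  (≤-reflexive (trans (cong (_* θ) (ℕ→ℚ-suc (length as))) (*-distribʳ-+ θ 1ℚ (ℕ→ℚ (length as)))))
  (+-mono-≤ (≤-trans (≤-reflexive (*-identityˡ θ)) θ≤a) (length*≤sum θ as θ≤as))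

sum≤length* : ∀ a as → Linked _≥_ (a ∷ as) → sumℚ as ≤ ℕ→ℚ (length as) * a
sum≤length* a [] _ = ≤-reflexive (sym (*-zeroˡ a))
sum≤length* a (b ∷ as) (b≤a ∷ desc) = ≤-trans (+-mono-≤ b≤a (≤-trans (sum≤length* b as desc) (*-monoˡ-≤-0≤′ b≤a)))
  (≤-reflexive (trans (solve 2 (λ a k → a :+ k :* a := (con 1ℚ :+ k) :* a) refl a (ℕ→ℚ (length as))) (cong (_* a) (sym (ℕ→ℚ-suc (length as))))))
  where
  *-monoˡ-≤-0≤′ : b ≤ a → ℕ→ℚ (length as) * b ≤ ℕ→ℚ (length as) * a
  *-monoˡ-≤-0≤′ = *-monoˡ-≤-0≤ (0≤ℕ→ℚ (length as))

-- Chebyshev's sum inequality for a nonincreasing sequence against the decreasing weights N - t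
chebyshev : ∀ N as → Linked _≥_ as → length as ℕ.≤ N →
  (ℕ→ℚ 2 * ℕ→ℚ N + 1ℚ) * sumℚ as ≤ ℕ→ℚ 2 * weightedSum (λ t → ℕ→ℚ (N ℕ.∸ t)) as + ℕ→ℚ (length as) * sumℚ as
chebyshev N [] _ _ = ≤-reflexive (trans (*-zeroʳ (ℕ→ℚ 2 * ℕ→ℚ N + 1ℚ)) (sym (cong₂ _+_ (*-zeroʳ (ℕ→ℚ 2)) (*-zeroʳ 0ℚ))))
chebyshev (suc N) (a ∷ as) desc (ℕ.s≤s len≤N) =
  0≤q-p⇒p≤q (≤-trans (+-pres-0≤ (p≤q⇒0≤q-p (chebyshev N as (Linked.tail desc) len≤N)) (p≤q⇒0≤q-p (sum≤length* a as desc)))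
                     (≤-reflexive identity))
  where
  two = ℕ→ℚ 2
  S = sumℚ as
  Wt = weightedSum (λ t → ℕ→ℚ (N ℕ.∸ t)) as
  identity : (ℕ→ℚ 2 * Wt + ℕ→ℚ (length as) * S - (ℕ→ℚ 2 * ℕ→ℚ N + 1ℚ) * S) + (ℕ→ℚ (length as) * a - S)
             ≡ (ℕ→ℚ 2 * (a * ℕ→ℚ (suc N) + Wt) + ℕ→ℚ (suc (length as)) * (a + S)) - (ℕ→ℚ 2 * ℕ→ℚ (suc N) + 1ℚ) * (a + S)
  identity rewrite ℕ→ℚ-suc N | ℕ→ℚ-suc (length as) =
    solve 5 (λ a S Wt N k → (con two :* Wt :+ k :* S :- (con two :* N :+ con 1ℚ) :* S) :+ (k :* a :- S)
       := (con two :* (a :* (con 1ℚ :+ N) :+ Wt) :+ (con 1ℚ :+ k) :* (a :+ S)) :- (con two :* (con 1ℚ :+ N) :+ con 1ℚ) :* (a :+ S))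
      refl a S Wt (ℕ→ℚ N) (ℕ→ℚ (length as))

*-pres-0< : ∀ {p q} → 0ℚ < p → 0ℚ < q → 0ℚ < p * q
*-pres-0< {p} {q} 0<p 0<q = positive⁻¹ (p * q) {{pos*pos⇒pos p {{positive 0<p}} q {{positive 0<q}}}}

-- k peeled and m remaining vertices, x = W_R, R₁ = ALG_P.  After scaling by 72γW the gap between the two
-- sides is the explicit nonnegative combination E of the hypotheses.
pmr-bound : ∀ (n k m γ W x ρ R₁ ALG : ℚ) → n ≡ k + m → 0ℚ ≤ k → 0ℚ ≤ m → 1ℚ ≤ γ → 0ℚ < W → 0ℚ ≤ x → x ≤ W →
  0ℚ ≤ ρ → ρ * W ≤ x →
  ℕ→ℚ 2 * γ * k * W ≤ n * x →
  (ℕ→ℚ 2 * n + 1ℚ) * x ≤ ℕ→ℚ 2 * R₁ + k * x →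
  ℕ→ℚ 3 * R₁ + ℕ→ℚ 2 * m * (W - x) ≤ ℕ→ℚ 3 * ALG →
  n * W * ((ℕ→ℚ 2 ÷' ℕ→ℚ 3) + ((γ - 1ℚ) ÷' (ℕ→ℚ 3 * γ)) * ρ + (1ℚ ÷' (ℕ→ℚ 12 * γ)) * (ρ * ρ)) ≤ ALG
pmr-bound .(k + m) k m γ W x ρ R₁ ALG refl 0≤k 0≤m 1≤γ 0<W 0≤x x≤W 0≤ρ ρW≤x threshold-bound chebyshev-bound cost-bound =
  *-cancelˡ-≤-0< 0<c (begin
      c * (n * W * (a + b * ρ + d * (ρ * ρ)))
    ≡⟨ scale ⟩
      M
    ≤⟨ ≤-trans (≤-reflexive (sym (+-identityʳ M))) (+-monoʳ-≤ M 0≤E) ⟩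
      M + E
    ≡⟨ certificate ⟩
      q 24 * γ * W * (q 3 * R₁ + q 2 * m * (W - x))
    ≤⟨ *-monoˡ-≤-0≤ (*-pres-0≤ (*-pres-0≤ (0≤ℕ→ℚ 24) 0≤γ) 0≤W) cost-bound ⟩
      q 24 * γ * W * (q 3 * ALG)
    ≡⟨ solve 3 (λ γ W A → con (q 24) :* γ :* W :* (con (q 3) :* A) := (con (q 72) :* γ :* W) :* A) refl γ W ALG ⟩
      c * ALG
    ∎)
  where
  open ≤-Reasoning
  q = ℕ→ℚ
  n = k + m
  a = q 2 ÷' q 3
  b = (γ - 1ℚ) ÷' (q 3 * γ)
  d = 1ℚ ÷' (q 12 * γ)
  c = q 72 * γ * W
  0<γ : 0ℚ < γ
  0<γ = <-≤-trans (*<* (ℤ.+<+ (ℕ.s≤s ℕ.z≤n))) 1≤γ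
  0≤γ = <⇒≤ 0<γ
  0≤W = <⇒≤ 0<W
  0<c : 0ℚ < c
  0<c = *-pres-0< (*-pres-0< (0<ℕ→ℚ-suc 71) 0<γ) 0<W
  0≤n : 0ℚ ≤ n
  0≤n = +-pres-0≤ 0≤k 0≤m
  M = n * W * W * (q 48 * γ + q 24 * (γ - 1ℚ) * ρ + q 6 * (ρ * ρ))
  E = q 36 * γ * W * (q 2 * R₁ + k * x - (q 2 * n + 1ℚ) * x)
      + q 6 * (q 4 * (γ - 1ℚ) * n * W * (x - ρ * W) + n * (x - ρ * W) * (x + ρ * W)
               + (n * x - q 2 * γ * k * W) * (q 4 * W - x) + q 6 * γ * x * W)
  0≤4W-x : 0ℚ ≤ q 4 * W - x
  0≤4W-x = ≤-trans (+-pres-0≤ (p≤q⇒0≤q-p x≤W) (*-pres-0≤ (0≤ℕ→ℚ 3) 0≤W))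
                   (≤-reflexive (solve 2 (λ W x → (W :- x) :+ con (q 3) :* W := con (q 4) :* W :- x) refl W x))
  0≤E : 0ℚ ≤ E
  0≤E = +-pres-0≤ (*-pres-0≤ (*-pres-0≤ (*-pres-0≤ (0≤ℕ→ℚ 36) 0≤γ) 0≤W) (p≤q⇒0≤q-p chebyshev-bound))
          (*-pres-0≤ (0≤ℕ→ℚ 6)
            (+-pres-0≤ (+-pres-0≤ (+-pres-0≤
              (*-pres-0≤ (*-pres-0≤ (*-pres-0≤ (*-pres-0≤ (0≤ℕ→ℚ 4) (p≤q⇒0≤q-p 1≤γ)) 0≤n) 0≤W) (p≤q⇒0≤q-p ρW≤x))
              (*-pres-0≤ (*-pres-0≤ 0≤n (p≤q⇒0≤q-p ρW≤x)) (+-pres-0≤ 0≤x (*-pres-0≤ 0≤ρ 0≤W))))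
              (*-pres-0≤ (p≤q⇒0≤q-p threshold-bound) 0≤4W-x))
              (*-pres-0≤ (*-pres-0≤ (*-pres-0≤ (0≤ℕ→ℚ 6) 0≤γ) 0≤x) 0≤W)))
  3γb≡γ-1 : q 3 * γ * b ≡ γ - 1ℚ
  3γb≡γ-1 = *-÷'-cancel (γ - 1ℚ) (q 3 * γ) (0<⇒≢0 (*-pres-0< (0<ℕ→ℚ-suc 2) 0<γ))
  12γd≡1 : q 12 * γ * d ≡ 1ℚ
  12γd≡1 = *-÷'-cancel 1ℚ (q 12 * γ) (0<⇒≢0 (*-pres-0< (0<ℕ→ℚ-suc 11) 0<γ))
  scale : c * (n * W * (a + b * ρ + d * (ρ * ρ))) ≡ M
  scale = begin-equality
      c * (n * W * (a + b * ρ + d * (ρ * ρ)))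
    ≡⟨ solve 7 (λ n W γ ρ a b d → (con (q 72) :* γ :* W) :* (n :* W :* (a :+ b :* ρ :+ d :* (ρ :* ρ)))
          := n :* W :* W :* (con (q 24) :* (con (q 3) :* a) :* γ :+ con (q 24) :* (con (q 3) :* γ :* b) :* ρ
                             :+ con (q 6) :* (con (q 12) :* γ :* d) :* (ρ :* ρ))) refl n W γ ρ a b d ⟩
      n * W * W * (q 24 * (q 3 * a) * γ + q 24 * (q 3 * γ * b) * ρ + q 6 * (q 12 * γ * d) * (ρ * ρ))
    ≡⟨ cong₂ (λ u v → n * W * W * (q 24 * (q 3 * a) * γ + q 24 * u * ρ + q 6 * v * (ρ * ρ))) 3γb≡γ-1 12γd≡1 ⟩
      n * W * W * (q 24 * (q 3 * a) * γ + q 24 * (γ - 1ℚ) * ρ + q 6 * 1ℚ * (ρ * ρ))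
    ≡⟨ cong (λ v → n * W * W * (q 48 * γ + q 24 * (γ - 1ℚ) * ρ + v * (ρ * ρ))) (*-identityʳ (q 6)) ⟩
      M
    ∎
  certificate : M + E ≡ q 24 * γ * W * (q 3 * R₁ + q 2 * m * (W - x))
  certificate = solve 7 (λ k m γ W x ρ R₁ →
      let n = k :+ m in
      (n :* W :* W :* (con (q 48) :* γ :+ con (q 24) :* (γ :- con 1ℚ) :* ρ :+ con (q 6) :* (ρ :* ρ)))
      :+ (con (q 36) :* γ :* W :* (con (q 2) :* R₁ :+ k :* x :- (con (q 2) :* n :+ con 1ℚ) :* x)
         :+ con (q 6) :* (con (q 4) :* (γ :- con 1ℚ) :* n :* W :* (x :- ρ :* W) :+ n :* (x :- ρ :* W) :* (x :+ ρ :* W)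
                          :+ (n :* x :- con (q 2) :* γ :* k :* W) :* (con (q 4) :* W :- x) :+ con (q 6) :* γ :* x :* W))
      := con (q 24) :* γ :* W :* (con (q 3) :* R₁ :+ con (q 2) :* m :* (W :- x))) refl k m γ W x ρ R₁

module Cost (n : ℕ) (w : Fin n → Fin n → ℚ) where
  open Instance n
  open PairSums n
  open OutputTree n

  ALG≡sumPairs-𝔼lca : ∀ peel → ALG-P w peel + ALG-R w peel ≡ sumPairs (λ i j → w i j * 𝔼lca peel i j)
  ALG≡sumPairs-𝔼lca peel = begin
      ALG-P w peel + ALG-R w peel
    ≡⟨ sym (sumℚ-map-+ _ _ D) ⟩
      sumℚ (map (λ x → proj₁ x * sumPairs (λ i j → if red i j then G (proj₂ x) i j else 0ℚ)
                      + proj₁ x * sumPairs (λ i j → if not (red i j) then G (proj₂ x) i j else 0ℚ)) D)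
    ≡⟨ sumℚ-map-cong D (λ x → trans (sym (*-distribˡ-+ (proj₁ x) _ _))
         (cong (proj₁ x *_) (trans (sym (sumPairs-+ _ _)) (sumPairs-cong (λ i j _ → red+rest (red i j) (G (proj₂ x) i j)))))) ⟩
      sumℚ (map (λ x → proj₁ x * sumPairs (G (proj₂ x))) D)
    ≡⟨ sumℚ-sumPairs-comm D proj₁ (λ x → G (proj₂ x)) ⟩
      sumPairs (λ i j → sumℚ (map (λ x → proj₁ x * G (proj₂ x) i j) D))
    ≡⟨ sumPairs-cong (λ i j _ → trans (sumℚ-map-cong D (λ x → solve 3 (λ q a b → q :* (a :* b) := a :* (q :* b)) refl (proj₁ x) (w i j) (ℕ→ℚ (lcaSizeM (proj₂ x) i j))))
                                      (sumℚ-map-*ˡ (w i j) (λ x → proj₁ x * ℕ→ℚ (lcaSizeM (proj₂ x) i j)) D)) ⟩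
      sumPairs (λ i j → w i j * 𝔼lca peel i j)
    ∎
    where
    open ≡-Reasoning
    D = outputDist peel
    red : Fin n → Fin n → Bool
    red i j = mem i peel ∨ mem j peel
    G : Maybe Tree → Fin n → Fin n → ℚ
    G t i j = w i j * ℕ→ℚ (lcaSizeM t i j)
    red+rest : ∀ b (X : ℚ) → (if b then X else 0ℚ) + (if not b then X else 0ℚ) ≡ X
    red+rest true X = +-identityʳ X
    red+rest false X = +-identityˡ X

module Estimates (n : ℕ) (w : Fin n → Fin n → ℚ) (w-sym : ∀ i j → w i j ≡ w j i) (w-nonNeg : ∀ i j → 0ℚ ≤ w i j)
                 (γ : ℚ) (peel : List (Fin n)) (po : Instance.PeelOff n w γ [] peel) where
  open Instance n
  open Membership n
  open PairSums n
  open PeelOffPhase n w γ w-sym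
  open Remaining n
  open OutputTree n
  open Cost n w

  k = length peel
  m = length (remaining peel)
  W = totalW w
  x = redW w peel
  degrees = peelDegrees [] peel
  R₁ = weightedSum (λ t → ℕ→ℚ (n ℕ.∸ t)) degrees
  nd = peelOff-noDup po

  n≡k+m : ℕ→ℚ n ≡ ℕ→ℚ k + ℕ→ℚ m
  n≡k+m = trans (cong ℕ→ℚ (trans (sym (length-remaining peel nd)) (ℕₚ.+-comm m k))) (ℕ→ℚ-+ k m)

  red : Fin n → Fin n → Bool
  red i j = mem i peel ∨ mem j peel

  W-x≡rest : W - x ≡ sumPairs (λ i j → if red i j then 0ℚ else w i j)
  W-x≡rest = trans (cong (_- x) W≡x+rest) (solve 2 (λ a b → (a :+ b) :- a := b) refl x _)
    where
    W≡x+rest : W ≡ x + sumPairs (λ i j → if red i j then 0ℚ else w i j)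
    W≡x+rest = trans (sumPairs-cong (λ i j _ → sym (split i j))) (sumPairs-+ _ _)
      where
      split : ∀ i j → (if red i j then w i j else 0ℚ) + (if red i j then 0ℚ else w i j) ≡ w i j
      split i j with red i j
      ... | true = +-identityʳ _
      ... | false = +-identityˡ _

  0≤x : 0ℚ ≤ x
  0≤x = sumPairs-nonNeg (λ i j _ → red-nonNeg i j)
    where
    red-nonNeg : ∀ i j → 0ℚ ≤ (if red i j then w i j else 0ℚ)
    red-nonNeg i j with red i j
    ... | true = w-nonNeg i j
    ... | false = ≤-refl

  x≤W : x ≤ W
  x≤W = 0≤q-p⇒p≤q (≤-trans (sumPairs-nonNeg (λ i j _ → rest-nonNeg i j)) (≤-reflexive (sym W-x≡rest)))
    where
    rest-nonNeg : ∀ i j → 0ℚ ≤ (if red i j then 0ℚ else w i j)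
    rest-nonNeg i j with red i j
    ... | true = ≤-refl
    ... | false = w-nonNeg i j

  -- a red edge costs n − t where t is the step its first endpoint is peeled; a remaining edge costs ≥ 2m/3 in expectation
  cost-bound : ℕ→ℚ 3 * R₁ + ℕ→ℚ 2 * ℕ→ℚ m * (W - x) ≤ ℕ→ℚ 3 * (ALG-P w peel + ALG-R w peel)
  cost-bound = begin
      ℕ→ℚ 3 * R₁ + ℕ→ℚ 2 * ℕ→ℚ m * (W - x)
    ≡⟨ cong₂ _+_ (cong (ℕ→ℚ 3 *_) (sym (sumPairs-peeledCost po _))) (cong (ℕ→ℚ 2 * ℕ→ℚ m *_) W-x≡rest) ⟩
      ℕ→ℚ 3 * sumPairs (peeledCost [] peel c) + ℕ→ℚ 2 * ℕ→ℚ m * sumPairs (λ i j → if red i j then 0ℚ else w i j)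
    ≡⟨ sym (trans (sumPairs-+ _ _) (cong₂ _+_ (sumPairs-*ˡ (ℕ→ℚ 3) _) (sumPairs-*ˡ (ℕ→ℚ 2 * ℕ→ℚ m) _))) ⟩
      sumPairs (λ i j → ℕ→ℚ 3 * peeledCost [] peel c i j + ℕ→ℚ 2 * ℕ→ℚ m * (if red i j then 0ℚ else w i j))
    ≤⟨ sumPairs-mono (λ i j i<j → per-edge i j (λ i≡j → ℕₚ.<-irrefl (cong toℕ i≡j) i<j)) ⟩
      sumPairs (λ i j → ℕ→ℚ 3 * (w i j * 𝔼lca peel i j))
    ≡⟨ trans (sumPairs-*ˡ (ℕ→ℚ 3) _) (cong (ℕ→ℚ 3 *_) (sym (ALG≡sumPairs-𝔼lca peel))) ⟩
      ℕ→ℚ 3 * (ALG-P w peel + ALG-R w peel)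
    ∎
    where
    open ≤-Reasoning
    c : ℕ → ℚ
    c t = ℕ→ℚ (n ℕ.∸ t)
    peeled-edge : ∀ i j → i ≢ j → red i j ≡ true →
      ℕ→ℚ 3 * (w i j * c (firstHit peel i j)) + ℕ→ℚ 2 * ℕ→ℚ m * 0ℚ ≤ ℕ→ℚ 3 * (w i j * 𝔼lca peel i j)
    peeled-edge i j i≢j hit = ≤-reflexive (trans (trans (cong (ℕ→ℚ 3 * (w i j * c (firstHit peel i j)) +_) (*-zeroʳ (ℕ→ℚ 2 * ℕ→ℚ m))) (+-identityʳ _))
                                                  (cong (λ z → ℕ→ℚ 3 * (w i j * z)) (sym (𝔼lca-peeled peel nd i j i≢j hit))))
    per-edge : ∀ i j → i ≢ j → ℕ→ℚ 3 * peeledCost [] peel c i j + ℕ→ℚ 2 * ℕ→ℚ m * (if red i j then 0ℚ else w i j)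
                                ≤ ℕ→ℚ 3 * (w i j * 𝔼lca peel i j)
    per-edge i j i≢j with mem i peel in i∈ | mem j peel in j∈
    ... | true | _ = peeled-edge i j i≢j (cong (_∨ mem j peel) i∈)
    ... | false | true = peeled-edge i j i≢j (trans (cong (_∨ mem j peel) i∈) j∈)
    ... | false | false = begin
        ℕ→ℚ 3 * 0ℚ + ℕ→ℚ 2 * ℕ→ℚ m * w i j
      ≡⟨ trans (cong (_+ ℕ→ℚ 2 * ℕ→ℚ m * w i j) (*-zeroʳ (ℕ→ℚ 3)))
               (trans (+-identityˡ _) (trans (*-comm (ℕ→ℚ 2 * ℕ→ℚ m) (w i j)) (cong (w i j *_) (sym (ℕ→ℚ-* 2 m))))) ⟩
        w i j * ℕ→ℚ (2 ℕ.* m)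
      ≤⟨ *-monoˡ-≤-0≤ (w-nonNeg i j) (𝔼lca-remaining-≥ peel i j i≢j i∈ j∈) ⟩
        w i j * (ℕ→ℚ 3 * 𝔼lca peel i j)
      ≡⟨ solve 3 (λ a b t → a :* (t :* b) := t :* (a :* b)) refl (w i j) (𝔼lca peel i j) (ℕ→ℚ 3) ⟩
        ℕ→ℚ 3 * (w i j * 𝔼lca peel i j)
      ∎

  chebyshev-bound : (ℕ→ℚ 2 * ℕ→ℚ n + 1ℚ) * x ≤ ℕ→ℚ 2 * R₁ + ℕ→ℚ k * x
  chebyshev-bound = subst (λ s → (ℕ→ℚ 2 * ℕ→ℚ n + 1ℚ) * s ≤ ℕ→ℚ 2 * R₁ + ℕ→ℚ k * s) (sym (redW≡sum-peelDegrees po))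
    (subst (λ l → (ℕ→ℚ 2 * ℕ→ℚ n + 1ℚ) * sumℚ degrees ≤ ℕ→ℚ 2 * R₁ + ℕ→ℚ l * sumℚ degrees) (length-peelDegrees [] peel)
      (chebyshev n degrees (peelDegrees-descending w-nonNeg po)
        (ℕₚ.≤-trans (ℕₚ.≤-reflexive (length-peelDegrees [] peel))
                    (ℕₚ.≤-trans (ℕₚ.m≤n+m k m) (ℕₚ.≤-reflexive (length-remaining peel nd))))))

  -- every peeled vertex had degree at least the threshold 2γW/n
  threshold-bound : 1 ℕ.≤ n → ℕ→ℚ 2 * γ * ℕ→ℚ k * W ≤ ℕ→ℚ n * x
  threshold-bound 1≤n = begin
      ℕ→ℚ 2 * γ * ℕ→ℚ k * W
    ≡⟨ solve 4 (λ t g k W → t :* g :* k :* W := k :* (g :* (t :* W))) refl (ℕ→ℚ 2) γ (ℕ→ℚ k) W ⟩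
      ℕ→ℚ k * (γ * (ℕ→ℚ 2 * W))
    ≡⟨ cong (ℕ→ℚ k *_) (sym n*threshold) ⟩
      ℕ→ℚ k * (ℕ→ℚ n * threshold w γ)
    ≡⟨ solve 3 (λ k n t → k :* (n :* t) := n :* (k :* t)) refl (ℕ→ℚ k) (ℕ→ℚ n) (threshold w γ) ⟩
      ℕ→ℚ n * (ℕ→ℚ k * threshold w γ)
    ≤⟨ *-monoˡ-≤-0≤ (0≤ℕ→ℚ n) (subst₂ (λ l s → ℕ→ℚ l * threshold w γ ≤ s) (length-peelDegrees [] peel) (sym (redW≡sum-peelDegrees po))
                                 (length*≤sum (threshold w γ) degrees (peelDegrees-≥-threshold po))) ⟩
      ℕ→ℚ n * x
    ∎
    where
    open ≤-Reasoning
    0<ℕ→ℚ : ∀ N → 1 ℕ.≤ N → 0ℚ < ℕ→ℚ N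
    0<ℕ→ℚ (suc N) _ = 0<ℕ→ℚ-suc N
    n*threshold : ℕ→ℚ n * threshold w γ ≡ γ * (ℕ→ℚ 2 * W)
    n*threshold = trans (solve 3 (λ a g b → a :* (g :* b) := g :* (a :* b)) refl (ℕ→ℚ n) γ ((ℕ→ℚ 2 * W) ÷' ℕ→ℚ n))
                        (cong (γ *_) (*-÷'-cancel (ℕ→ℚ 2 * W) (ℕ→ℚ n) (0<⇒≢0 (0<ℕ→ℚ n 1≤n))))

theorem4 : (n : ℕ) → 1 Data.Nat.≤ n → (w : Fin n → Fin n → ℚ) →
    (∀ i j → w i j ≡ w j i) → (∀ i j → 0ℚ ≤ w i j) →
    (γ Rstar : ℚ) → 1ℚ ≤ γ → 0ℚ < Rstar → Rstar < ½ →
    (peel : List (Fin n)) → Instance.PeelOff n w γ [] peel →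
    Rstar * Instance.totalW n w < Instance.redW n w peel →
    ℕ→ℚ n * Instance.totalW n w *
    ((ℕ→ℚ 2 ÷' ℕ→ℚ 3) + ((γ - 1ℚ) ÷' (ℕ→ℚ 3 * γ)) * Rstar + (1ℚ ÷' (ℕ→ℚ 12 * γ)) * (Rstar * Rstar))
    ≤ Instance.ALG-P n w peel + Instance.ALG-R n w peel
theorem4 n 1≤n w w-sym w-nonNeg γ R* 1≤γ 0<R* _ peel po R*W<x =
  pmr-bound (ℕ→ℚ n) (ℕ→ℚ k) (ℕ→ℚ m) γ W x R* R₁ _ n≡k+m (0≤ℕ→ℚ k) (0≤ℕ→ℚ m) 1≤γ 0<W 0≤x x≤W (<⇒≤ 0<R*) (<⇒≤ R*W<x)
    (threshold-bound 1≤n) chebyshev-bound cost-bound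
  where
  open Estimates n w w-sym w-nonNeg γ peel po
  0<W : 0ℚ < W
  0<W = <-≤-trans (≤-<-trans (*-pres-0≤ (<⇒≤ 0<R*) (≤-trans 0≤x x≤W)) R*W<x) x≤W
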